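{- If $\sigma\in\mathcal{G}_{n,k}$ and $x$ is a valley of $\sigma$, then $\varphi(\sigma, x)\in \mathcal{G}_{n,k}$ and \begin{align*} \operatorname{res}\varphi(\sigma, x)&=\begin{cases} \operatorname{res}\sigma+1& \text{if $x$ is good,} \\ \operatorname{res}\sigma-1& \text{if $x$ is bad;} \end{cases}\qquad \operatorname{les}\varphi(\sigma, x)=\begin{cases} \operatorname{les}\sigma-1& \text{if $x$ is good,}\\ \operatorname{les}\sigma+1& \text{if $x$ is bad.} \end{cases} \end{align*}
   Context: For a permutation $\sigma=\sigma_1\ldots\sigma_n$ of $[n]$ with $\sigma_0=\sigma_{n+1}=0$, $\sigma_i$ is a peak if $\sigma_{i-1}<\sigma_i>\sigma_{i+1}$, a valley if $\sigma_{i-1}>\sigma_i<\sigma_{i+1}$, a double ascent if $\sigma_{i-1}<\sigma_i<\sigma_{i+1}$, a double descent if $\sigma_{i-1}>\sigma_i>\sigma_{i+1}$. $\operatorname{les}\sigma$ is the number of pairs $(i,j)$ with $2\le i<j\le n$ and $\sigma_{i-1}>\sigma_j>\sigma_i$; $\operatorname{res}\sigma$ is the number of pairs $(i,j)$ with $1\le i<j\le n-1$ and $\sigma_{j+1}>\sigma_i>\sigma_j$. $\mathcal{G}_{n,k}$ is the set of permutations of $[n]$ with $k$ valleys and no double descents. For a letter $x$ of $\sigma$, the $x$-factorization is the unique factorization $\sigma=w_1w_2xw_4w_5$ such that $w_1$ is empty or ends with a letter $<x$, $w_2$ and $w_4$ are empty or have all letters $>x$, and $w_5$ is empty or begins with a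 letter $<x$. For $\sigma$ without double descents and a valley $x$ (so $w_2,w_4$ nonempty), put $y_1=\min(w_2)$, $y_2=\min(w_4)$, $y=\min(y_1,y_2)$; $x$ is good if $y_1>y_2$ and bad if $y_1<y_2$. The transform $\varphi(\sigma,x)$ is: (i) if $y$ is a peak: $w_1\,y\,x\,w_2\,w_5$ when $y=y_2$ (then $w_4=y$), and $w_1\,w_4\,x\,y\,w_5$ when $y=y_1$ (then $w_2=y$); (ii) if $y$ is a double ascent: $w_1\,yw_2\,x\,w''\,w_5$ when $y=y_2$ and $w_4=yw''$, and $w_1\,w''\,x\,yw_4\,w_5$ when $y=y_1$ and $w_2=yw''$; (iii) if $y$ is a valley: $w_1\,w_2yw'\,x\,w''\,w_5$ when $y=y_2$ and $w_4=w'yw''$, and $w_1\,w'\,x\,w''yw_4\,w_5$ when $y=y_1$ and $w_2=w'yw''$ (with $w',w''$ nonempty). -}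

module Defs where

open import Data.Nat using (ℕ; zero; suc; _+_; _∸_; _<_; _≤_; _>_; _⊓_)
open import Data.Nat.Properties using (_<?_)
open import Data.List using (List; []; _∷_; _++_; _∷ʳ_; length; map; filter; upTo)
open import Data.Nat.ListAction using (sum)
open import Data.List.Relation.Unary.All using (All)
open import Data.List.Relation.Binary.Permutation.Propositional using (_↭_)
open import Data.Product using (Σ; ∃; ∃-syntax; _×_; _,_)
open import Data.Product.Properties using ()
open import Relation.Nullary using (¬_)
open import Relation.Nullary.Decidable using (_×-dec_)
open import Relation.Binary.PropositionalEquality using (_≡_; _≢_)
open import Data.Sum using (_⊎_)

-- Permutations are lists of letters; [1..n] is the list 1,2,…,n.
oneTo : ℕ → List ℕ
oneTo n = map suc (upTo n)

range : ℕ → ℕ → List ℕ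
range a b = map (a +_) (upTo (suc b ∸ a))

-- 0-indexed lookup, 0 outside the list
lookup0 : List ℕ → ℕ → ℕ
lookup0 []       _       = 0
lookup0 (a ∷ _)  zero    = a
lookup0 (_ ∷ as) (suc i) = lookup0 as i

-- σ_i with 1-based indexing and the convention σ_0 = σ_{n+1} = 0
at : List ℕ → ℕ → ℕ
at σ zero    = 0
at σ (suc i) = lookup0 σ i

PeakAt ValleyAt DAscAt DDescAt : List ℕ → ℕ → Set
PeakAt   σ i = at σ (i ∸ 1) < at σ i × at σ i > at σ (suc i)
ValleyAt σ i = at σ (i ∸ 1) > at σ i × at σ i < at σ (suc i)
DAscAt   σ i = at σ (i ∸ 1) < at σ i × at σ i < at σ (suc i)
DDescAt  σ i = at σ (i ∸ 1) > at σ i × at σ i > at σ (suc i)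

IsPeak IsValley IsDAsc : List ℕ → ℕ → Set
IsPeak   σ y = ∃[ i ] (1 ≤ i × i ≤ length σ × at σ i ≡ y × PeakAt σ i)
IsValley σ y = ∃[ i ] (1 ≤ i × i ≤ length σ × at σ i ≡ y × ValleyAt σ i)
IsDAsc   σ y = ∃[ i ] (1 ≤ i × i ≤ length σ × at σ i ≡ y × DAscAt σ i)

NoDDesc : List ℕ → Set
NoDDesc σ = ∀ i → 1 ≤ i → i ≤ length σ → ¬ DDescAt σ i

valleys : List ℕ → ℕ
valleys σ = length (filter (λ i → (at σ i <? at σ (i ∸ 1)) ×-dec (at σ i <? at σ (suc i)))
                           (range 1 (length σ)))

les : List ℕ → ℕ
les σ = sum (map (λ i → length (filter (λ j → (at σ j <? at σ (i ∸ 1)) ×-dec (at σ i <? at σ j))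
                                       (range (suc i) (length σ))))
                 (range 2 (length σ)))

res : List ℕ → ℕ
res σ = sum (map (λ i → length (filter (λ j → (at σ i <? at σ (suc j)) ×-dec (at σ j <? at σ i))
                                       (range (suc i) (length σ ∸ 1))))
                 (range 1 (length σ ∸ 1)))

InG : ℕ → ℕ → List ℕ → Set
InG n k σ = (σ ↭ oneTo n) × valleys σ ≡ k × NoDDesc σ

-- minimum of a (nonempty) list; only used on nonempty lists
minimum : List ℕ → ℕ
minimum []       = 0
minimum (a ∷ as) = go a as
  where
  go : ℕ → List ℕ → ℕ
  go m []       = m
  go m (b ∷ bs) = go (m ⊓ b) bs

XFact : List ℕ → ℕ → List ℕ → List ℕ → List ℕ → List ℕ → Set
XFact σ x w1 w2 w4 w5 =
  σ ≡ w1 ++ w2 ++ x ∷ w4 ++ w5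
  × (w1 ≡ [] ⊎ ∃[ u ] ∃[ z ] (w1 ≡ u ∷ʳ z × z < x))
  × All (x <_) w2
  × All (x <_) w4
  × (w5 ≡ [] ⊎ ∃[ z ] ∃[ v ] (w5 ≡ z ∷ v × z < x))

Good Bad : List ℕ → ℕ → Set
Good σ x = ∃[ w1 ] ∃[ w2 ] ∃[ w4 ] ∃[ w5 ] (XFact σ x w1 w2 w4 w5 × minimum w2 > minimum w4)
Bad  σ x = ∃[ w1 ] ∃[ w2 ] ∃[ w4 ] ∃[ w5 ] (XFact σ x w1 w2 w4 w5 × minimum w2 < minimum w4)

data PhiCase (σ : List ℕ) (x : ℕ) (w1 w2 w4 w5 : List ℕ) : List ℕ → Set where
  peak₂ : let y = minimum w2 ⊓ minimum w4 in
          IsPeak σ y → y ≡ minimum w4 →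
          PhiCase σ x w1 w2 w4 w5 (w1 ++ y ∷ x ∷ w2 ++ w5)
  peak₁ : let y = minimum w2 ⊓ minimum w4 in
          IsPeak σ y → y ≡ minimum w2 →
          PhiCase σ x w1 w2 w4 w5 (w1 ++ w4 ++ x ∷ y ∷ w5)
  dasc₂ : let y = minimum w2 ⊓ minimum w4 in
          IsDAsc σ y → y ≡ minimum w4 → (w'' : List ℕ) → w4 ≡ y ∷ w'' →
          PhiCase σ x w1 w2 w4 w5 (w1 ++ (y ∷ w2) ++ x ∷ w'' ++ w5)
  dasc₁ : let y = minimum w2 ⊓ minimum w4 in
          IsDAsc σ y → y ≡ minimum w2 → (w'' : List ℕ) → w2 ≡ y ∷ w'' →
          PhiCase σ x w1 w2 w4 w5 (w1 ++ w'' ++ x ∷ y ∷ w4 ++ w5)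
  val₂  : let y = minimum w2 ⊓ minimum w4 in
          IsValley σ y → y ≡ minimum w4 → (w' w'' : List ℕ) → w' ≢ [] → w'' ≢ [] →
          w4 ≡ w' ++ y ∷ w'' →
          PhiCase σ x w1 w2 w4 w5 (w1 ++ (w2 ++ y ∷ w') ++ x ∷ w'' ++ w5)
  val₁  : let y = minimum w2 ⊓ minimum w4 in
          IsValley σ y → y ≡ minimum w2 → (w' w'' : List ℕ) → w' ≢ [] → w'' ≢ [] →
          w2 ≡ w' ++ y ∷ w'' →
          PhiCase σ x w1 w2 w4 w5 (w1 ++ w' ++ x ∷ (w'' ++ y ∷ w4) ++ w5)

Phi : List ℕ → ℕ → List ℕ → Set
Phi σ x τ = ∃[ w1 ] ∃[ w2 ] ∃[ w4 ] ∃[ w5 ] (XFact σ x w1 w2 w4 w5 × PhiCase σ x w1 w2 w4 w5 τ)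

module Submission where

-- Write σ = w₁ w₂ x w₄ w₅ for the x-factorization. Every case of φ only rearranges the block
-- w₂ x w₄, whose letters are ≥ x, while w₁ ends and w₅ starts with a letter < x. Computed by
-- structural recursion, les, res, the number of valleys and the number of double descents split
-- into contributions of w₁, of the block, of w₅, and cross terms. The cross terms see the block
-- only through its multiset of letters, the adjacent pairs straddling a given letter, and the
-- shapes of its letters against boundary letters < x; all of these survive the rearrangement.
-- So τ ∈ 𝒢_{n,k}, and les and res change exactly as les′ and res′ of the block alone, by -1 and
-- +1 (or the reverse) in each of the three cases. Which direction occurs is decided by whether
-- y = min w₄ or y = min w₂, i.e. by goodness, using uniqueness of the x-factorization.

open import Defs
open import Data.Nat using (ℕ; zero; suc; _+_; _∸_; _<_; _≤_; _⊓_; z≤n; s≤s)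
open import Data.Nat.Properties
open import Data.Nat.Tactic.RingSolver using (solve-∀)
open import Data.Empty using (⊥; ⊥-elim)
open import Data.Unit using (⊤; tt)
open import Data.Sum using (_⊎_; inj₁; inj₂)
open import Data.Product using (∃-syntax; _×_; _,_; proj₁; proj₂)
open import Data.List using (List; []; _∷_; _++_; _∷ʳ_; length; map; filter; applyUpTo)
open import Data.List.Properties using (++-assoc; ∷-injective; ∷-injectiveʳ)
open import Data.List.Relation.Unary.All using (All; []; _∷_)
import Data.List.Relation.Unary.All as All
import Data.List.Relation.Unary.All.Properties as AllP
open import Data.List.Relation.Unary.Any using (here; there)
open import Data.List.Relation.Unary.AllPairs using ([]; _∷_)
open import Data.List.Membership.Propositional using (_∈_; _∉_)
open import Data.List.Membership.Propositional.Properties using (∈-++⁺ʳ; ∈-++⁺ˡ; ∈-map⁻; ∈-∃++)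
open import Data.List.Relation.Unary.Unique.Propositional using (Unique)
import Data.List.Relation.Unary.Unique.Propositional.Properties as UP
open import Data.List.Relation.Binary.Permutation.Propositional using (_↭_)
import Data.List.Relation.Binary.Permutation.Propositional as Perm
import Data.List.Relation.Binary.Permutation.Propositional.Properties as PP
open import Data.Nat.ListAction using (sum)
open import Relation.Nullary using (¬_; Dec; yes; no)
open import Relation.Nullary.Decidable using (_×-dec_)
open import Relation.Unary using (Pred; Decidable)
open import Relation.Binary using (tri<; tri≈; tri>)
open import Relation.Binary.PropositionalEquality
open import Function using (_∘_; id)

-- Indicators and finite sums

𝟙 : ∀ {P : Set} → Dec P → ℕ
𝟙 (yes _) = 1
𝟙 (no _)  = 0

𝟙-yes : ∀ {P : Set} (p? : Dec P) → P → 𝟙 p? ≡ 1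
𝟙-yes (yes _) _ = refl
𝟙-yes (no ¬p) p = ⊥-elim (¬p p)

𝟙-no : ∀ {P : Set} (p? : Dec P) → ¬ P → 𝟙 p? ≡ 0
𝟙-no (yes p) ¬p = ⊥-elim (¬p p)
𝟙-no (no _)  _  = refl

𝟙-no⁻ : ∀ {P : Set} (p? : Dec P) → 𝟙 p? ≡ 0 → ¬ P
𝟙-no⁻ (no ¬p) _ = ¬p

𝟙-cong : ∀ {P Q : Set} (p? : Dec P) (q? : Dec Q) → (P → Q) → (Q → P) → 𝟙 p? ≡ 𝟙 q?
𝟙-cong (yes _) (yes _) _ _ = refl
𝟙-cong (yes p) (no ¬q) f _ = ⊥-elim (¬q (f p))
𝟙-cong (no ¬p) (yes q) _ g = ⊥-elim (¬p (g q))
𝟙-cong (no _)  (no _)  _ _ = refl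

cong₃ : ∀ {A : Set} (f : A → A → A → ℕ) {a a′ b b′ c c′} →
  a ≡ a′ → b ≡ b′ → c ≡ c′ → f a b c ≡ f a′ b′ c′
cong₃ f refl refl refl = refl

sumBelow : (ℕ → ℕ) → ℕ → ℕ
sumBelow h zero    = 0
sumBelow h (suc k) = h 0 + sumBelow (h ∘ suc) k

sumBelow-cong : ∀ {h h′ : ℕ → ℕ} k → (∀ i → h i ≡ h′ i) → sumBelow h k ≡ sumBelow h′ k
sumBelow-cong zero    e = refl
sumBelow-cong (suc k) e = cong₂ _+_ (e 0) (sumBelow-cong k (e ∘ suc))

sumBelow-zero : ∀ {h} k → (∀ i → i < k → h i ≡ 0) → sumBelow h k ≡ 0
sumBelow-zero zero    f = refl
sumBelow-zero (suc k) f = cong₂ _+_ (f 0 (s≤s z≤n)) (sumBelow-zero k (λ i → f (suc i) ∘ s≤s))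

sumBelow-zero⁻ : ∀ {h} k → sumBelow h k ≡ 0 → ∀ i → i < k → h i ≡ 0
sumBelow-zero⁻ {h} (suc k) e zero    _         = m+n≡0⇒m≡0 (h 0) e
sumBelow-zero⁻ {h} (suc k) e (suc i) (s≤s i<k) = sumBelow-zero⁻ k (m+n≡0⇒n≡0 (h 0) e) i i<k

length-filter-map-applyUpTo : ∀ {P : Pred ℕ _} (P? : Decidable P) (g f : ℕ → ℕ) k →
  length (filter P? (map g (applyUpTo f k))) ≡ sumBelow (λ i → 𝟙 (P? (g (f i)))) k
length-filter-map-applyUpTo P? g f zero = refl
length-filter-map-applyUpTo P? g f (suc k) with P? (g (f 0))
... | yes _ = cong suc (length-filter-map-applyUpTo P? g (f ∘ suc) k)
... | no _  = length-filter-map-applyUpTo P? g (f ∘ suc) k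

sum-map-map-applyUpTo : ∀ (h g f : ℕ → ℕ) k → sum (map h (map g (applyUpTo f k))) ≡ sumBelow (h ∘ g ∘ f) k
sum-map-map-applyUpTo h g f zero    = refl
sum-map-map-applyUpTo h g f (suc k) = cong (h (g (f 0)) +_) (sum-map-map-applyUpTo h g (f ∘ suc) k)

sumMap : (ℕ → ℕ) → List ℕ → ℕ
sumMap h []       = 0
sumMap h (x ∷ xs) = h x + sumMap h xs

sumMap-+ : ∀ (f g : ℕ → ℕ) v → sumMap (λ c → f c + g c) v ≡ sumMap f v + sumMap g v
sumMap-+ f g [] = refl
sumMap-+ f g (x ∷ v) rewrite sumMap-+ f g v = lemma (f x) (g x) (sumMap f v) (sumMap g v)
  where
  lemma : ∀ a b c d → a + b + (c + d) ≡ a + c + (b + d)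
  lemma = solve-∀

sumMap-cong : ∀ {f g : ℕ → ℕ} v → (∀ c → f c ≡ g c) → sumMap f v ≡ sumMap g v
sumMap-cong []      e = refl
sumMap-cong (x ∷ v) e = cong₂ _+_ (e x) (sumMap-cong v e)

sumMap-congᴬ : ∀ {Q : ℕ → Set} {f g : ℕ → ℕ} {v} → All Q v → (∀ c → Q c → f c ≡ g c) →
  sumMap f v ≡ sumMap g v
sumMap-congᴬ []       e = refl
sumMap-congᴬ (q ∷ qs) e = cong₂ _+_ (e _ q) (sumMap-congᴬ qs e)

sumMap-zero : ∀ {f : ℕ → ℕ} v → (∀ c → f c ≡ 0) → sumMap f v ≡ 0
sumMap-zero []      e = refl
sumMap-zero (x ∷ v) e = cong₂ _+_ (e x) (sumMap-zero v e)

sumMap-zeroᴬ : ∀ {Q : ℕ → Set} {f : ℕ → ℕ} {v} → All Q v → (∀ c → Q c → f c ≡ 0) → sumMap f v ≡ 0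
sumMap-zeroᴬ []       e = refl
sumMap-zeroᴬ (q ∷ qs) e = cong₂ _+_ (e _ q) (sumMap-zeroᴬ qs e)

sumMap-++ : ∀ (f : ℕ → ℕ) u v → sumMap f (u ++ v) ≡ sumMap f u + sumMap f v
sumMap-++ f []      v = refl
sumMap-++ f (x ∷ u) v rewrite sumMap-++ f u v = sym (+-assoc (f x) _ _)

sumMap-↭ : ∀ (f : ℕ → ℕ) {u v} → u ↭ v → sumMap f u ≡ sumMap f v
sumMap-↭ f Perm.refl        = refl
sumMap-↭ f (Perm.prep x p)  = cong (f x +_) (sumMap-↭ f p)
sumMap-↭ f (Perm.swap {ys = ys} x y p) rewrite sumMap-↭ f p = lemma (f x) (f y) (sumMap f ys)
  where
  lemma : ∀ a b c → a + (b + c) ≡ b + (a + c)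
  lemma = solve-∀
sumMap-↭ f (Perm.trans p q) = trans (sumMap-↭ f p) (sumMap-↭ f q)

-- Comparison patterns of letters

between : (hi lo c : ℕ) → ℕ
between hi lo c = 𝟙 ((c <? hi) ×-dec (lo <? c))

valley₃ ddesc₃ : (p a q : ℕ) → ℕ
valley₃ p a q = 𝟙 ((a <? p) ×-dec (a <? q))
ddesc₃  p a q = 𝟙 ((a <? p) ×-dec (q <? a))

between-above : ∀ hi lo c → hi ≤ c → between hi lo c ≡ 0
between-above hi lo c hi≤c = 𝟙-no _ λ (c<hi , _) → <⇒≱ c<hi hi≤c

between-below : ∀ hi lo c → c ≤ lo → between hi lo c ≡ 0
between-below hi lo c c≤lo = 𝟙-no _ λ (_ , lo<c) → <⇒≱ lo<c c≤lo

between-empty : ∀ hi lo c → hi ≤ lo → between hi lo c ≡ 0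
between-empty hi lo c hi≤lo = 𝟙-no _ λ (c<hi , lo<c) → <⇒≱ (<-trans lo<c c<hi) hi≤lo

between-self : ∀ hi lo → between hi lo lo ≡ 0
between-self hi lo = between-below hi lo lo ≤-refl

between-inside : ∀ hi lo c → lo < c → c < hi → between hi lo c ≡ 1
between-inside hi lo c lo<c c<hi = 𝟙-yes _ (c<hi , lo<c)

between-lower-irrelevant : ∀ hi lo lo′ c → lo < c → lo′ < c → between hi lo c ≡ between hi lo′ c
between-lower-irrelevant hi lo lo′ c lo<c lo′<c =
  𝟙-cong _ _ (λ (c<hi , _) → c<hi , lo′<c) (λ (c<hi , _) → c<hi , lo<c)

between-exchange : ∀ {p q r s} c → p ≤ q → q < r → r ≤ s →
  between s q c + between r p c ≡ between r q c + between s p c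
between-exchange {p} {q} {r} {s} c p≤q q<r r≤s with c <? s | q <? c | c <? r | p <? c
... | _      | yes q<c | _       | no p≮c  = ⊥-elim (p≮c (≤-<-trans p≤q q<c))
... | no c≮s | _       | yes c<r | _       = ⊥-elim (c≮s (<-≤-trans c<r r≤s))
... | yes _  | no q≮c  | no c≮r  | _       = ⊥-elim (<⇒≱ q<r (≤-trans (≮⇒≥ c≮r) (≮⇒≥ q≮c)))
... | yes _  | yes _   | yes _   | yes _   = refl
... | yes _  | yes _   | no _    | yes _   = refl
... | yes _  | no _    | yes _   | yes _   = refl
... | yes _  | no _    | yes _   | no _    = refl
... | no _   | yes _   | no _    | yes _   = refl
... | no _   | no _    | no _    | yes _   = refl
... | no _   | no _    | no _    | no _    = refl

between-exchange′ : ∀ {x y s t} c → x < y → y < s → y < t →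
  between s x c + between t y c ≡ between s y c + between t x c
between-exchange′ {x} {y} {s} {t} c x<y y<s y<t with c <? s | x <? c | c <? t | y <? c
... | _      | no x≮c | _      | yes y<c = ⊥-elim (x≮c (<-trans x<y y<c))
... | no c≮s | yes _  | _      | no y≮c  = ⊥-elim (c≮s (≤-<-trans (≮⇒≥ y≮c) y<s))
... | _      | yes _  | no c≮t | no y≮c  = ⊥-elim (c≮t (≤-<-trans (≮⇒≥ y≮c) y<t))
... | yes _  | yes _  | yes _  | yes _   = refl
... | yes _  | yes _  | yes _  | no _    = refl
... | yes _  | yes _  | no _   | yes _   = refl
... | yes _  | no _   | yes _  | no _    = refl
... | yes _  | no _   | no _   | no _    = refl
... | no _   | yes _  | yes _  | yes _   = refl
... | no _   | yes _  | no _   | yes _   = refl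
... | no _   | no _   | yes _  | no _    = refl
... | no _   | no _   | no _   | no _    = refl

SameSide : (a p p′ : ℕ) → Set
SameSide a p p′ = (p < a × p′ < a) ⊎ (a < p × a < p′)

SameSide-sym : ∀ {a p p′} → SameSide a p p′ → SameSide a p′ p
SameSide-sym (inj₁ (p<a , p′<a)) = inj₁ (p′<a , p<a)
SameSide-sym (inj₂ (a<p , a<p′)) = inj₂ (a<p′ , a<p)

SameSide-above : ∀ {a p p′} → SameSide a p p′ → a < p → a < p′
SameSide-above (inj₁ (p<a , _)) a<p = ⊥-elim (<-asym a<p p<a)
SameSide-above (inj₂ (_ , a<p′)) _  = a<p′

SameSide-below : ∀ {a p p′} → SameSide a p p′ → p < a → p′ < a
SameSide-below (inj₁ (_ , p′<a)) _  = p′<a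
SameSide-below (inj₂ (a<p , _)) p<a = ⊥-elim (<-asym a<p p<a)

LeftLocal RightLocal : (ℕ → ℕ → ℕ → ℕ) → Set
LeftLocal  G = ∀ p p′ a q → SameSide a p p′ → G p a q ≡ G p′ a q
RightLocal G = ∀ p a q q′ → SameSide a q q′ → G p a q ≡ G p a q′

ValleyConstant : (ℕ → ℕ → ℕ → ℕ) → Set
ValleyConstant G = ∀ p a q p′ a′ q′ → a < p → a < q → a′ < p′ → a′ < q′ → G p a q ≡ G p′ a′ q′

valley₃-left : LeftLocal valley₃
valley₃-left p p′ a q s = 𝟙-cong _ _
  (λ (a<p , a<q) → SameSide-above s a<p , a<q) (λ (a<p′ , a<q) → SameSide-above (SameSide-sym s) a<p′ , a<q)

valley₃-right : RightLocal valley₃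
valley₃-right p a q q′ s = 𝟙-cong _ _
  (λ (a<p , a<q) → a<p , SameSide-above s a<q) (λ (a<p , a<q′) → a<p , SameSide-above (SameSide-sym s) a<q′)

valley₃-constant : ValleyConstant valley₃
valley₃-constant p a q p′ a′ q′ a<p a<q a′<p′ a′<q′ =
  trans (𝟙-yes _ (a<p , a<q)) (sym (𝟙-yes _ (a′<p′ , a′<q′)))

ddesc₃-left : LeftLocal ddesc₃
ddesc₃-left p p′ a q s = 𝟙-cong _ _
  (λ (a<p , q<a) → SameSide-above s a<p , q<a) (λ (a<p′ , q<a) → SameSide-above (SameSide-sym s) a<p′ , q<a)

ddesc₃-right : RightLocal ddesc₃
ddesc₃-right p a q q′ s = 𝟙-cong _ _
  (λ (a<p , q<a) → a<p , SameSide-below s q<a) (λ (a<p , q′<a) → a<p , SameSide-below (SameSide-sym s) q′<a)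

ddesc₃-constant : ValleyConstant ddesc₃
ddesc₃-constant p a q p′ a′ q′ _ a<q _ a′<q′ =
  trans (𝟙-no _ λ (_ , q<a) → <-asym a<q q<a) (sym (𝟙-no _ λ (_ , q′<a′) → <-asym a′<q′ q′<a′))

record LocalStatistic (G : ℕ → ℕ → ℕ → ℕ) : Set where
  field
    left   : LeftLocal G
    right  : RightLocal G
    valley : ValleyConstant G

valley₃-local : LocalStatistic valley₃
valley₃-local = record { left = valley₃-left ; right = valley₃-right ; valley = valley₃-constant }

ddesc₃-local : LocalStatistic ddesc₃
ddesc₃-local = record { left = ddesc₃-left ; right = ddesc₃-right ; valley = ddesc₃-constant }

-- Structural recursions for les, res, valleys and double descents

headOr : ℕ → List ℕ → ℕ
headOr q []      = q
headOr q (b ∷ _) = b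

lastOr : ℕ → List ℕ → ℕ
lastOr p []      = p
lastOr p (a ∷ w) = lastOr a w

ascentsAcross descentsAcross : List ℕ → ℕ → ℕ
ascentsAcross  (b ∷ c ∷ w) a = between c b a + ascentsAcross (c ∷ w) a
ascentsAcross  _           a = 0
descentsAcross (b ∷ c ∷ w) a = between b c a + descentsAcross (c ∷ w) a
descentsAcross _           a = 0

les′ : List ℕ → ℕ
les′ (a ∷ b ∷ w) = sumMap (between a b) w + les′ (b ∷ w)
les′ _           = 0

res′ : List ℕ → ℕ
res′ []      = 0
res′ (a ∷ w) = ascentsAcross w a + res′ w

countTriples : (ℕ → ℕ → ℕ → ℕ) → ℕ → List ℕ → ℕ → ℕ
countTriples G p []      q = 0
countTriples G p (a ∷ w) q = G p a (headOr q w) + countTriples G a w q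

framed : ℕ → List ℕ → ℕ → ℕ → ℕ
framed p w       q zero    = p
framed p []      q (suc i) = q
framed p (a ∷ w) q (suc i) = framed a w q i

lookup0≗framed : ∀ p w i → lookup0 w i ≡ framed p w 0 (suc i)
lookup0≗framed p []      i       = refl
lookup0≗framed p (a ∷ w) zero    = refl
lookup0≗framed p (a ∷ w) (suc i) = lookup0≗framed a w i

at≗framed : ∀ σ i → at σ i ≡ framed 0 σ 0 i
at≗framed σ zero    = refl
at≗framed σ (suc i) = lookup0≗framed 0 σ i

lesOf : (ℕ → ℕ) → ℕ → ℕ
lesOf f n = sumBelow (λ i → sumBelow (λ j → between (f (suc i)) (f (2 + i)) (f (3 + i + j)))
                                     (suc n ∸ (3 + i)))
                     (suc n ∸ 2)

les≡lesOf : ∀ σ → les σ ≡ lesOf (at σ) (length σ)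
les≡lesOf σ = trans (sum-map-map-applyUpTo _ (2 +_) id (suc (length σ) ∸ 2))
  (sumBelow-cong (suc (length σ) ∸ 2) λ i → length-filter-map-applyUpTo _ (3 + i +_) id (suc (length σ) ∸ (3 + i)))

lesOf-cong : ∀ {f f′} n → (∀ i → f i ≡ f′ i) → lesOf f n ≡ lesOf f′ n
lesOf-cong n e = sumBelow-cong (suc n ∸ 2) λ i → sumBelow-cong (suc n ∸ (3 + i)) λ j →
  cong₃ between (e _) (e _) (e _)

sumBelow-framed : ∀ (h : ℕ → ℕ) b w q → sumBelow (λ j → h (framed b w q (suc j))) (length w) ≡ sumMap h w
sumBelow-framed h b []      q = refl
sumBelow-framed h b (c ∷ w) q = cong (h c +_) (sumBelow-framed h c w q)

lesOf-framed : ∀ p w q → lesOf (framed p w q) (length w) ≡ les′ w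
lesOf-framed p []          q = refl
lesOf-framed p (a ∷ [])    q = refl
lesOf-framed p (a ∷ b ∷ w) q = cong₂ _+_ (sumBelow-framed (between a b) b w q) (lesOf-framed a (b ∷ w) q)

les≡les′ : ∀ σ → les σ ≡ les′ σ
les≡les′ σ = begin
  les σ                              ≡⟨ les≡lesOf σ ⟩
  lesOf (at σ) (length σ)            ≡⟨ lesOf-cong (length σ) (at≗framed σ) ⟩
  lesOf (framed 0 σ 0) (length σ)    ≡⟨ lesOf-framed 0 σ 0 ⟩
  les′ σ                             ∎
  where open ≡-Reasoning

resOf : (ℕ → ℕ) → ℕ → ℕ
resOf f n = sumBelow (λ i → sumBelow (λ j → between (f (3 + i + j)) (f (2 + i + j)) (f (suc i)))
                                     (suc (n ∸ 1) ∸ (2 + i)))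
                     (suc (n ∸ 1) ∸ 1)

res≡resOf : ∀ σ → res σ ≡ resOf (at σ) (length σ)
res≡resOf σ = trans (sum-map-map-applyUpTo _ (1 +_) id (suc (length σ ∸ 1) ∸ 1))
  (sumBelow-cong (suc (length σ ∸ 1) ∸ 1) λ i → length-filter-map-applyUpTo _ (2 + i +_) id (suc (length σ ∸ 1) ∸ (2 + i)))

resOf-cong : ∀ {f f′} n → (∀ i → f i ≡ f′ i) → resOf f n ≡ resOf f′ n
resOf-cong n e = sumBelow-cong (suc (n ∸ 1) ∸ 1) λ i → sumBelow-cong (suc (n ∸ 1) ∸ (2 + i)) λ j →
  cong₃ between (e _) (e _) (e _)

sumBelow-framed-ascents : ∀ b w q a →
  sumBelow (λ j → between (framed b w q (suc j)) (framed b w q j) a) (length w) ≡ ascentsAcross (b ∷ w) a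
sumBelow-framed-ascents b []      q a = refl
sumBelow-framed-ascents b (c ∷ w) q a = cong (between c b a +_) (sumBelow-framed-ascents c w q a)

resOf-framed : ∀ p w q → resOf (framed p w q) (length w) ≡ res′ w
resOf-framed p []          q = refl
resOf-framed p (a ∷ [])    q = refl
resOf-framed p (a ∷ b ∷ w) q = cong₂ _+_ (sumBelow-framed-ascents b w q a) (resOf-framed a (b ∷ w) q)

res≡res′ : ∀ σ → res σ ≡ res′ σ
res≡res′ σ = begin
  res σ                              ≡⟨ res≡resOf σ ⟩
  resOf (at σ) (length σ)            ≡⟨ resOf-cong (length σ) (at≗framed σ) ⟩
  resOf (framed 0 σ 0) (length σ)    ≡⟨ resOf-framed 0 σ 0 ⟩
  res′ σ                             ∎
  where open ≡-Reasoning

countOf : (ℕ → ℕ → ℕ → ℕ) → (ℕ → ℕ) → ℕ → ℕ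
countOf G f n = sumBelow (λ i → G (f i) (f (suc i)) (f (2 + i))) n

countOf-cong : ∀ G {f f′} n → (∀ i → f i ≡ f′ i) → countOf G f n ≡ countOf G f′ n
countOf-cong G n e = sumBelow-cong n λ i → cong₃ G (e _) (e _) (e _)

countOf-framed : ∀ G p w q → countOf G (framed p w q) (length w) ≡ countTriples G p w q
countOf-framed G p []          q = refl
countOf-framed G p (a ∷ [])    q = refl
countOf-framed G p (a ∷ b ∷ w) q = cong (G p a b +_) (countOf-framed G a (b ∷ w) q)

countTriples≡countOf : ∀ G σ → countTriples G 0 σ 0 ≡ countOf G (at σ) (length σ)
countTriples≡countOf G σ = trans (sym (countOf-framed G 0 σ 0)) (sym (countOf-cong G (length σ) (at≗framed σ)))

valleys≡countTriples : ∀ σ → valleys σ ≡ countTriples valley₃ 0 σ 0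
valleys≡countTriples σ =
  trans (length-filter-map-applyUpTo _ (1 +_) id (length σ)) (sym (countTriples≡countOf valley₃ σ))

NoDDesc⇒countTriples≡0 : ∀ σ → NoDDesc σ → countTriples ddesc₃ 0 σ 0 ≡ 0
NoDDesc⇒countTriples≡0 σ nd = trans (countTriples≡countOf ddesc₃ σ)
  (sumBelow-zero (length σ) λ i i<n → 𝟙-no _ (nd (suc i) (s≤s z≤n) i<n))

countTriples≡0⇒NoDDesc : ∀ σ → countTriples ddesc₃ 0 σ 0 ≡ 0 → NoDDesc σ
countTriples≡0⇒NoDDesc σ e (suc i) _ i<n =
  𝟙-no⁻ _ (sumBelow-zero⁻ (length σ) (trans (sym (countTriples≡countOf ddesc₃ σ)) e) i i<n)

-- Shapes of a letter read off from its neighbours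

Distinct : List ℕ → Set
Distinct []      = ⊤
Distinct (a ∷ w) = (a ∉ w) × Distinct w

Distinct-++ˡ : ∀ u v → Distinct (u ++ v) → Distinct u
Distinct-++ˡ []      v d         = tt
Distinct-++ˡ (a ∷ u) v (a∉ , d) = (λ a∈u → a∉ (∈-++⁺ˡ a∈u)) , Distinct-++ˡ u v d

Distinct-++ʳ : ∀ u v → Distinct (u ++ v) → Distinct v
Distinct-++ʳ []      v d       = d
Distinct-++ʳ (a ∷ u) v (_ , d) = Distinct-++ʳ u v d

Distinct-disjoint : ∀ u v {e} → Distinct (u ++ v) → e ∈ u → e ∉ v
Distinct-disjoint (a ∷ u) v (a∉ , d) (here refl) e∈v = a∉ (∈-++⁺ʳ u e∈v)
Distinct-disjoint (a ∷ u) v (_ , d)  (there e∈u) e∈v = Distinct-disjoint u v d e∈u e∈v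

Distinct-split : ∀ P x Q → Distinct (P ++ x ∷ Q) → (x ∉ P) × (x ∉ Q)
Distinct-split P x Q d = (λ x∈P → Distinct-disjoint P (x ∷ Q) d x∈P (here refl)) , proj₁ (Distinct-++ʳ P (x ∷ Q) d)

Distinct-↭ : ∀ {u v} → u ↭ v → Distinct u → Distinct v
Distinct-↭ Perm.refl d = d
Distinct-↭ (Perm.prep x p) (x∉ , d) = (λ x∈ → x∉ (PP.∈-resp-↭ (Perm.↭-sym p) x∈)) , Distinct-↭ p d
Distinct-↭ (Perm.swap x y p) (x∉ , y∉ , d) =
  (λ { (here refl) → x∉ (here refl) ; (there y∈) → y∉ (PP.∈-resp-↭ (Perm.↭-sym p) y∈) }) ,
  (λ x∈ → x∉ (there (PP.∈-resp-↭ (Perm.↭-sym p) x∈))) , Distinct-↭ p d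
Distinct-↭ (Perm.trans p q) d = Distinct-↭ q (Distinct-↭ p d)

Unique⇒Distinct : ∀ {w : List ℕ} → Unique w → Distinct w
Unique⇒Distinct {[]}    _             = tt
Unique⇒Distinct {a ∷ w} u@(_ ∷ uniq) = UP.Unique[x∷xs]⇒x∉xs u , Unique⇒Distinct uniq

Distinct-oneTo : ∀ n → Distinct (oneTo n)
Distinct-oneTo n = Unique⇒Distinct (UP.map⁺ suc-injective (UP.upTo⁺ n))

oneTo-positive : ∀ {x} n → x ∈ oneTo n → 0 < x
oneTo-positive n x∈ with ∈-map⁻ suc x∈
... | _ , _ , refl = s≤s z≤n

InG⇒Distinct : ∀ {n k σ} → InG n k σ → Distinct σ
InG⇒Distinct {n} (σ↭ , _) = Distinct-↭ (Perm.↭-sym σ↭) (Distinct-oneTo n)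

framed-before : ∀ p P y Q q → framed p (P ++ y ∷ Q) q (length P) ≡ lastOr p P
framed-before p []      y Q q = refl
framed-before p (c ∷ P) y Q q = framed-before c P y Q q

framed-at : ∀ p P y Q q → framed p (P ++ y ∷ Q) q (suc (length P)) ≡ y
framed-at p []      y Q q = refl
framed-at p (c ∷ P) y Q q = framed-at c P y Q q

framed-after : ∀ p P y Q q → framed p (P ++ y ∷ Q) q (2 + length P) ≡ headOr q Q
framed-after p []      y []      q = refl
framed-after p []      y (b ∷ Q) q = refl
framed-after p (c ∷ P) y Q       q = framed-after c P y Q q

framed-∈ : ∀ p w q i → i < length w → framed p w q (suc i) ∈ w
framed-∈ p (a ∷ w) q zero    _         = here refl
framed-∈ p (a ∷ w) q (suc i) (s≤s i<n) = there (framed-∈ a w q i i<n)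

framed-injective : ∀ p P y Q q i → Distinct (P ++ y ∷ Q) → i < length (P ++ y ∷ Q) →
  framed p (P ++ y ∷ Q) q (suc i) ≡ y → i ≡ length P
framed-injective p []      y Q q zero    _          _         _ = refl
framed-injective p []      y Q q (suc i) (y∉Q , _) (s≤s i<n) e = ⊥-elim (y∉Q (subst (_∈ Q) e (framed-∈ y Q q i i<n)))
framed-injective p (c ∷ P) y Q q zero    (c∉ , _)  _         e = ⊥-elim (c∉ (subst (_∈ (P ++ y ∷ Q)) (sym e) (∈-++⁺ʳ P (here refl))))
framed-injective p (c ∷ P) y Q q (suc i) (_ , d)   (s≤s i<n) e = cong suc (framed-injective c P y Q q i d i<n e)

length-split : ∀ P (y : ℕ) Q → suc (length P) ≤ length (P ++ y ∷ Q)
length-split []      y Q = s≤s z≤n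
length-split (c ∷ P) y Q = s≤s (length-split P y Q)

at-split : ∀ P y Q → at (P ++ y ∷ Q) (suc (length P)) ≡ y
at-split P y Q = trans (at≗framed (P ++ y ∷ Q) (suc (length P))) (framed-at 0 P y Q 0)

at-before-split : ∀ P y Q → at (P ++ y ∷ Q) (length P) ≡ lastOr 0 P
at-before-split P y Q = trans (at≗framed (P ++ y ∷ Q) (length P)) (framed-before 0 P y Q 0)

at-after-split : ∀ P y Q → at (P ++ y ∷ Q) (2 + length P) ≡ headOr 0 Q
at-after-split P y Q = trans (at≗framed (P ++ y ∷ Q) (2 + length P)) (framed-after 0 P y Q 0)

at-neighbours : ∀ P y Q i → Distinct (P ++ y ∷ Q) → 1 ≤ i → i ≤ length (P ++ y ∷ Q) →
  at (P ++ y ∷ Q) i ≡ y →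
  (at (P ++ y ∷ Q) (i ∸ 1) ≡ lastOr 0 P) × (at (P ++ y ∷ Q) (suc i) ≡ headOr 0 Q)
at-neighbours P y Q (suc i) d _ i<n e
  with framed-injective 0 P y Q 0 i d i<n (trans (sym (at≗framed (P ++ y ∷ Q) (suc i))) e)
... | refl = at-before-split P y Q , at-after-split P y Q

IsPeak⁻ : ∀ P y Q → Distinct (P ++ y ∷ Q) → IsPeak (P ++ y ∷ Q) y → (lastOr 0 P < y) × (headOr 0 Q < y)
IsPeak⁻ P y Q d (i , 1≤i , i≤n , e , l , r) with at-neighbours P y Q i d 1≤i i≤n e
... | el , er = subst₂ _<_ el e l , subst₂ _<_ er e r

IsDAsc⁻ : ∀ P y Q → Distinct (P ++ y ∷ Q) → IsDAsc (P ++ y ∷ Q) y → (lastOr 0 P < y) × (y < headOr 0 Q)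
IsDAsc⁻ P y Q d (i , 1≤i , i≤n , e , l , r) with at-neighbours P y Q i d 1≤i i≤n e
... | el , er = subst₂ _<_ el e l , subst₂ _<_ e er r

IsValley⁻ : ∀ P y Q → Distinct (P ++ y ∷ Q) → IsValley (P ++ y ∷ Q) y → (y < lastOr 0 P) × (y < headOr 0 Q)
IsValley⁻ P y Q d (i , 1≤i , i≤n , e , l , r) with at-neighbours P y Q i d 1≤i i≤n e
... | el , er = subst₂ _<_ e el l , subst₂ _<_ e er r

IsPeak⁺ : ∀ P y Q → lastOr 0 P < y → headOr 0 Q < y → IsPeak (P ++ y ∷ Q) y
IsPeak⁺ P y Q l r = suc (length P) , s≤s z≤n , length-split P y Q , at-split P y Q ,
  subst₂ _<_ (sym (at-before-split P y Q)) (sym (at-split P y Q)) l ,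
  subst₂ _<_ (sym (at-after-split P y Q)) (sym (at-split P y Q)) r

IsDAsc⁺ : ∀ P y Q → lastOr 0 P < y → y < headOr 0 Q → IsDAsc (P ++ y ∷ Q) y
IsDAsc⁺ P y Q l r = suc (length P) , s≤s z≤n , length-split P y Q , at-split P y Q ,
  subst₂ _<_ (sym (at-before-split P y Q)) (sym (at-split P y Q)) l ,
  subst₂ _<_ (sym (at-split P y Q)) (sym (at-after-split P y Q)) r

IsValley⁺ : ∀ P y Q → y < lastOr 0 P → y < headOr 0 Q → IsValley (P ++ y ∷ Q) y
IsValley⁺ P y Q l r = suc (length P) , s≤s z≤n , length-split P y Q , at-split P y Q ,
  subst₂ _<_ (sym (at-split P y Q)) (sym (at-before-split P y Q)) l ,
  subst₂ _<_ (sym (at-split P y Q)) (sym (at-after-split P y Q)) r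

NoDDesc-split : ∀ P y Q → NoDDesc (P ++ y ∷ Q) → y < lastOr 0 P → headOr 0 Q < y → ⊥
NoDDesc-split P y Q nd l r = nd (suc (length P)) (s≤s z≤n) (length-split P y Q)
  (subst₂ _<_ (sym (at-split P y Q)) (sym (at-before-split P y Q)) l ,
   subst₂ _<_ (sym (at-after-split P y Q)) (sym (at-split P y Q)) r)

IsValley⇒∈ : ∀ σ x → IsValley σ x → x ∈ σ
IsValley⇒∈ σ x (suc i , _ , i<n , e , _) = subst (_∈ σ) (trans (sym (at≗framed σ (suc i))) e) (framed-∈ 0 σ 0 i i<n)

-- The statistics on concatenations

lastOr-∷ʳ : ∀ p u z → lastOr p (u ∷ʳ z) ≡ z
lastOr-∷ʳ p []      z = refl
lastOr-∷ʳ p (a ∷ u) z = lastOr-∷ʳ a u z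

lastOr-++ : ∀ p u v → lastOr p (u ++ v) ≡ lastOr (lastOr p u) v
lastOr-++ p []      v = refl
lastOr-++ p (a ∷ u) v = lastOr-++ a u v

All-lastOr : ∀ {Q : ℕ → Set} m w → All Q (m ∷ w) → Q (lastOr m w)
All-lastOr m []      (q ∷ _)  = q
All-lastOr m (b ∷ w) (_ ∷ qs) = All-lastOr b w qs

headOr-++ : ∀ q u v → headOr q (u ++ v) ≡ headOr (headOr q v) u
headOr-++ q []      v = refl
headOr-++ q (a ∷ u) v = refl

ascentsAcross-under : ∀ {c} w → All (c <_) w → ascentsAcross w c ≡ 0
ascentsAcross-under []           _        = refl
ascentsAcross-under (b ∷ [])     _        = refl
ascentsAcross-under (b ∷ b′ ∷ w) (p ∷ ps) = cong₂ _+_ (between-below b′ b _ (<⇒≤ p)) (ascentsAcross-under (b′ ∷ w) ps)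

descentsAcross-under : ∀ {c} w → All (c <_) w → descentsAcross w c ≡ 0
descentsAcross-under []           _             = refl
descentsAcross-under (b ∷ [])     _             = refl
descentsAcross-under (b ∷ b′ ∷ w) (_ ∷ p′ ∷ ps) =
  cong₂ _+_ (between-below b b′ _ (<⇒≤ p′)) (descentsAcross-under (b′ ∷ w) (p′ ∷ ps))

ascentsAcross-self : ∀ a w → ascentsAcross (a ∷ w) a ≡ ascentsAcross w a
ascentsAcross-self a []      = refl
ascentsAcross-self a (b ∷ w) = cong (_+ ascentsAcross (b ∷ w) a) (between-self b a)

ascentsAcross-++ : ∀ b u v a → ascentsAcross (b ∷ u ++ v) a ≡ ascentsAcross (b ∷ u) a + ascentsAcross (lastOr b u ∷ v) a
ascentsAcross-++ b []      v a = refl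
ascentsAcross-++ b (c ∷ u) v a rewrite ascentsAcross-++ c u v a = sym (+-assoc (between c b a) _ _)

descentsAcross-++ : ∀ b u v c → descentsAcross (b ∷ u ++ v) c ≡ descentsAcross (b ∷ u) c + descentsAcross (lastOr b u ∷ v) c
descentsAcross-++ b []      v c = refl
descentsAcross-++ b (d ∷ u) v c rewrite descentsAcross-++ d u v c = sym (+-assoc (between b d c) _ _)

ascentsAcross-dropHead : ∀ t w a → headOr 0 w ≤ t → ascentsAcross (t ∷ w) a ≡ ascentsAcross w a
ascentsAcross-dropHead t []      a _ = refl
ascentsAcross-dropHead t (h ∷ w) a h≤t = cong (_+ ascentsAcross (h ∷ w) a) (between-empty h t a h≤t)

descentsAcross-∷ʳ : ∀ u h c → descentsAcross (u ∷ʳ h) c ≡ descentsAcross u c + between (lastOr 0 u) h c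
descentsAcross-∷ʳ []           h c = sym (between-above 0 h c z≤n)
descentsAcross-∷ʳ (a ∷ [])     h c = +-identityʳ _
descentsAcross-∷ʳ (a ∷ a′ ∷ u) h c rewrite descentsAcross-∷ʳ (a′ ∷ u) h c = sym (+-assoc (between a a′ c) _ _)

descentsAcross-∷ʳ-lower : ∀ w x z c → x < c → z < c → descentsAcross (w ∷ʳ z) c ≡ descentsAcross (w ∷ʳ x) c
descentsAcross-∷ʳ-lower w x z c x<c z<c = begin
  descentsAcross (w ∷ʳ z) c                          ≡⟨ descentsAcross-∷ʳ w z c ⟩
  descentsAcross w c + between (lastOr 0 w) z c      ≡⟨ cong (descentsAcross w c +_) (between-lower-irrelevant _ z x c z<c x<c) ⟩
  descentsAcross w c + between (lastOr 0 w) x c      ≡⟨ descentsAcross-∷ʳ w x c ⟨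
  descentsAcross (w ∷ʳ x) c                          ∎
  where open ≡-Reasoning

les′-++ : ∀ u v → les′ (u ++ v) ≡ les′ u + les′ v + sumMap (descentsAcross (u ∷ʳ headOr 0 v)) v
les′-++ [] v = sym (trans (cong (les′ v +_) (sumMap-zero v λ _ → refl)) (+-identityʳ _))
les′-++ (a ∷ []) [] = refl
les′-++ (a ∷ []) (b ∷ v) rewrite between-self a b | sumMap-cong {λ c → between a b c + 0} {between a b} v (λ c → +-identityʳ _) =
  +-comm (sumMap (between a b) v) _
les′-++ (a ∷ a′ ∷ u) v = begin
  sumMap (between a a′) (u ++ v) + les′ (a′ ∷ u ++ v)
    ≡⟨ cong₂ _+_ (sumMap-++ (between a a′) u v) (les′-++ (a′ ∷ u) v) ⟩
  sumMap (between a a′) u + sumMap (between a a′) v + (les′ (a′ ∷ u) + les′ v + D)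
    ≡⟨ lemma (sumMap (between a a′) u) (sumMap (between a a′) v) (les′ (a′ ∷ u)) (les′ v) D ⟩
  sumMap (between a a′) u + les′ (a′ ∷ u) + les′ v + (sumMap (between a a′) v + D)
    ≡⟨ cong (sumMap (between a a′) u + les′ (a′ ∷ u) + les′ v +_)
            (sumMap-+ (between a a′) (descentsAcross (a′ ∷ u ∷ʳ headOr 0 v)) v) ⟨
  sumMap (between a a′) u + les′ (a′ ∷ u) + les′ v + sumMap (descentsAcross (a ∷ a′ ∷ u ∷ʳ headOr 0 v)) v
    ∎
  where
  open ≡-Reasoning
  D = sumMap (descentsAcross (a′ ∷ u ∷ʳ headOr 0 v)) v
  lemma : ∀ a b c d e → a + b + (c + d + e) ≡ a + c + d + (b + e)
  lemma = solve-∀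

sumMap-lastOr-irrelevant : ∀ (g : ℕ → ℕ → ℕ) p p′ u → sumMap (g (lastOr p u)) u ≡ sumMap (g (lastOr p′ u)) u
sumMap-lastOr-irrelevant g p p′ []      = refl
sumMap-lastOr-irrelevant g p p′ (_ ∷ _) = refl

res′-++ : ∀ u v → res′ (u ++ v) ≡ res′ u + res′ v + sumMap (ascentsAcross (lastOr 0 u ∷ v)) u
res′-++ [] v = sym (+-identityʳ _)
res′-++ (a ∷ u) v
  rewrite res′-++ u v | sym (ascentsAcross-self a (u ++ v)) | ascentsAcross-++ a u v a | ascentsAcross-self a u
        | sumMap-lastOr-irrelevant (λ t → ascentsAcross (t ∷ v)) 0 a u =
  lemma (ascentsAcross u a) (ascentsAcross (lastOr a u ∷ v) a) (res′ u) (res′ v) (sumMap (ascentsAcross (lastOr a u ∷ v)) u)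
  where
  lemma : ∀ a b c d e → a + b + (c + d + e) ≡ a + c + d + (b + e)
  lemma = solve-∀

countTriples-++ : ∀ G p u v q → countTriples G p (u ++ v) q ≡ countTriples G p u (headOr q v) + countTriples G (lastOr p u) v q
countTriples-++ G p []      v q = refl
countTriples-++ G p (a ∷ u) v q rewrite headOr-++ q u v | countTriples-++ G a u v q = sym (+-assoc (G p a _) _ _)

countTriples-leftLocal : ∀ G → LeftLocal G → ∀ p p′ a w q → SameSide a p p′ →
  countTriples G p (a ∷ w) q ≡ countTriples G p′ (a ∷ w) q
countTriples-leftLocal G l p p′ a w q s = cong (_+ countTriples G a w q) (l p p′ a _ s)

countTriples-rightLocal : ∀ G → RightLocal G → ∀ p m w q q′ → SameSide (lastOr m w) q q′ →
  countTriples G p (m ∷ w) q ≡ countTriples G p (m ∷ w) q′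
countTriples-rightLocal G r p m []      q q′ s = cong (_+ 0) (r p m q q′ s)
countTriples-rightLocal G r p m (b ∷ w) q q′ s = cong (G p m b +_) (countTriples-rightLocal G r m b w q q′ s)

countTriples-local : ∀ {G} → LocalStatistic G → ∀ p p′ m w q q′ → p < m → p′ < m →
  q < lastOr m w → q′ < lastOr m w → countTriples G p (m ∷ w) q ≡ countTriples G p′ (m ∷ w) q′
countTriples-local {G} T p p′ m w q q′ p<m p′<m q<t q′<t =
  trans (countTriples-leftLocal G left p p′ m w q (inj₁ (p<m , p′<m)))
        (countTriples-rightLocal G right p′ m w q q′ (inj₁ (q<t , q′<t)))
  where open LocalStatistic T

-- Exchanging a block of large letters

les′-around : ∀ w1 m ms w5 → lastOr 0 w1 ≤ m →
  les′ (w1 ++ (m ∷ ms) ++ w5) ≡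
    les′ w1 + (les′ (m ∷ ms) + les′ w5 + sumMap (descentsAcross ((m ∷ ms) ∷ʳ headOr 0 w5)) w5)
            + sumMap (descentsAcross w1) ((m ∷ ms) ++ w5)
les′-around w1 m ms w5 l≤m = trans (les′-++ w1 ((m ∷ ms) ++ w5))
  (cong₂ (λ u v → les′ w1 + u + v) (les′-++ (m ∷ ms) w5)
    (sumMap-cong ((m ∷ ms) ++ w5) λ c →
      trans (descentsAcross-∷ʳ w1 m c) (trans (cong (descentsAcross w1 c +_) (between-empty _ _ c l≤m)) (+-identityʳ _))))

les′-exchange : ∀ w1 m ms m′ ms′ w5 → lastOr 0 w1 ≤ m → lastOr 0 w1 ≤ m′ → (m ∷ ms) ↭ (m′ ∷ ms′) →
  (∀ c → descentsAcross ((m ∷ ms) ∷ʳ headOr 0 w5) c ≡ descentsAcross ((m′ ∷ ms′) ∷ʳ headOr 0 w5) c) →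
  les′ (w1 ++ (m ∷ ms) ++ w5) + les′ (m′ ∷ ms′) ≡ les′ (w1 ++ (m′ ∷ ms′) ++ w5) + les′ (m ∷ ms)
les′-exchange w1 m ms m′ ms′ w5 l≤m l≤m′ M↭M′ e
  rewrite les′-around w1 m ms w5 l≤m | les′-around w1 m′ ms′ w5 l≤m′
        | sumMap-cong {descentsAcross ((m ∷ ms) ∷ʳ headOr 0 w5)} w5 e
        | sumMap-↭ (descentsAcross w1) (PP.++⁺ʳ w5 M↭M′) =
  lemma (les′ w1) (les′ (m ∷ ms)) (les′ (m′ ∷ ms′)) (les′ w5)
        (sumMap (descentsAcross ((m′ ∷ ms′) ∷ʳ headOr 0 w5)) w5) (sumMap (descentsAcross w1) ((m′ ∷ ms′) ++ w5))
  where
  lemma : ∀ a b b′ c d e → a + (b + c + d) + e + b′ ≡ a + (b′ + c + d) + e + b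
  lemma = solve-∀

res′-around : ∀ w1 m ms w5 → headOr 0 w5 ≤ lastOr m ms →
  res′ (w1 ++ (m ∷ ms) ++ w5) ≡
    res′ w1 + (res′ (m ∷ ms) + res′ w5 + sumMap (ascentsAcross w5) (m ∷ ms))
            + (sumMap (ascentsAcross (lastOr 0 w1 ∷ m ∷ ms)) w1 + sumMap (ascentsAcross w5) w1)
res′-around w1 m ms w5 h≤t = trans (res′-++ w1 ((m ∷ ms) ++ w5))
  (cong₂ (λ u v → res′ w1 + u + v)
    (trans (res′-++ (m ∷ ms) w5)
      (cong (res′ (m ∷ ms) + res′ w5 +_) (sumMap-cong (m ∷ ms) λ a → ascentsAcross-dropHead (lastOr m ms) w5 a h≤t)))
    (trans (sumMap-cong w1 λ a → trans (ascentsAcross-++ (lastOr 0 w1) (m ∷ ms) w5 a)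
                                        (cong (ascentsAcross (lastOr 0 w1 ∷ m ∷ ms) a +_) (ascentsAcross-dropHead (lastOr m ms) w5 a h≤t)))
           (sumMap-+ (ascentsAcross (lastOr 0 w1 ∷ m ∷ ms)) (ascentsAcross w5) w1)))

res′-exchange : ∀ w1 m ms m′ ms′ w5 → headOr 0 w5 ≤ lastOr m ms → headOr 0 w5 ≤ lastOr m′ ms′ →
  (m ∷ ms) ↭ (m′ ∷ ms′) →
  (∀ a → ascentsAcross (lastOr 0 w1 ∷ m ∷ ms) a ≡ ascentsAcross (lastOr 0 w1 ∷ m′ ∷ ms′) a) →
  res′ (w1 ++ (m ∷ ms) ++ w5) + res′ (m′ ∷ ms′) ≡ res′ (w1 ++ (m′ ∷ ms′) ++ w5) + res′ (m ∷ ms)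
res′-exchange w1 m ms m′ ms′ w5 h≤t h≤t′ M↭M′ e
  rewrite res′-around w1 m ms w5 h≤t | res′-around w1 m′ ms′ w5 h≤t′
        | sumMap-cong {ascentsAcross (lastOr 0 w1 ∷ m ∷ ms)} w1 e
        | sumMap-↭ (ascentsAcross w5) M↭M′ =
  lemma (res′ w1) (res′ (m ∷ ms)) (res′ (m′ ∷ ms′)) (res′ w5) (sumMap (ascentsAcross w5) (m′ ∷ ms′))
        (sumMap (ascentsAcross (lastOr 0 w1 ∷ m′ ∷ ms′)) w1 + sumMap (ascentsAcross w5) w1)
  where
  lemma : ∀ a b b′ c d e → a + (b + c + d) + e + b′ ≡ a + (b′ + c + d) + e + b
  lemma = solve-∀

countTriples-around : ∀ G w1 m ms w5 →
  countTriples G 0 (w1 ++ (m ∷ ms) ++ w5) 0 ≡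
    countTriples G 0 w1 m + countTriples G (lastOr 0 w1) (m ∷ ms) (headOr 0 w5) + countTriples G (lastOr m ms) w5 0
countTriples-around G w1 m ms w5 = trans (countTriples-++ G 0 w1 ((m ∷ ms) ++ w5) 0)
  (trans (cong (countTriples G 0 w1 m +_) (countTriples-++ G (lastOr 0 w1) (m ∷ ms) w5 0))
         (sym (+-assoc (countTriples G 0 w1 m) _ _)))

countTriples-exchange : ∀ {G} → LocalStatistic G → ∀ w1 m ms m′ ms′ w5 →
  lastOr 0 w1 < m → lastOr 0 w1 < m′ → headOr 0 w5 < lastOr m ms → headOr 0 w5 < lastOr m′ ms′ →
  countTriples G (lastOr 0 w1) (m ∷ ms) (headOr 0 w5) ≡ countTriples G (lastOr 0 w1) (m′ ∷ ms′) (headOr 0 w5) →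
  countTriples G 0 (w1 ++ (m ∷ ms) ++ w5) 0 ≡ countTriples G 0 (w1 ++ (m′ ∷ ms′) ++ w5) 0
countTriples-exchange {G} T w1 m ms m′ ms′ w5 l<m l<m′ h<t h<t′ e
  rewrite countTriples-around G w1 m ms w5 | countTriples-around G w1 m′ ms′ w5 | e =
  cong₂ (λ u v → u + countTriples G (lastOr 0 w1) (m′ ∷ ms′) (headOr 0 w5) + v) (before w1 l<m l<m′) (after w5 h<t h<t′)
  where
  open LocalStatistic T
  before : ∀ w1 → lastOr 0 w1 < m → lastOr 0 w1 < m′ → countTriples G 0 w1 m ≡ countTriples G 0 w1 m′
  before []      _   _    = refl
  before (a ∷ w) l<m l<m′ = countTriples-rightLocal G right 0 a w m m′ (inj₂ (l<m , l<m′))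
  after : ∀ w5 → headOr 0 w5 < lastOr m ms → headOr 0 w5 < lastOr m′ ms′ →
    countTriples G (lastOr m ms) w5 0 ≡ countTriples G (lastOr m′ ms′) w5 0
  after []      _   _    = refl
  after (c ∷ w) h<t h<t′ = countTriples-leftLocal G left _ _ c w 0 (inj₂ (h<t , h<t′))

SameCounts : (ℕ → ℕ → ℕ → ℕ) → ℕ → List ℕ → List ℕ → Set
SameCounts G x M M′ = ∀ l f → l < x → f < x → countTriples G l M f ≡ countTriples G l M′ f

-- Seen from surrounding letters < x the blocks M and M′ look alike; by exchange,
-- only les′ and res′ of the blocks themselves can tell them apart.
record Interchangeable (x : ℕ) (M M′ : List ℕ) : Set where
  field
    above       : All (x ≤_) M
    above′      : All (x ≤_) M′
    permutation : M ↭ M′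
    descents    : ∀ f c → f < x → descentsAcross (M ∷ʳ f) c ≡ descentsAcross (M′ ∷ʳ f) c
    ascents     : ∀ l c → l < x → ascentsAcross (l ∷ M) c ≡ ascentsAcross (l ∷ M′) c
    valleyCount : SameCounts valley₃ x M M′
    ddescCount  : SameCounts ddesc₃ x M M′

Interchangeable-sym : ∀ {x M M′} → Interchangeable x M M′ → Interchangeable x M′ M
Interchangeable-sym i = record
  { above       = above′
  ; above′      = above
  ; permutation = Perm.↭-sym permutation
  ; descents    = λ f c f<x → sym (descents f c f<x)
  ; ascents     = λ l c l<x → sym (ascents l c l<x)
  ; valleyCount = λ l f l<x f<x → sym (valleyCount l f l<x f<x)
  ; ddescCount  = λ l f l<x f<x → sym (ddescCount l f l<x f<x)
  }
  where open Interchangeable i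

exchange : ∀ {n k x} w1 m ms m′ ms′ w5 → lastOr 0 w1 < x → headOr 0 w5 < x →
  Interchangeable x (m ∷ ms) (m′ ∷ ms′) → InG n k (w1 ++ (m ∷ ms) ++ w5) →
  InG n k (w1 ++ (m′ ∷ ms′) ++ w5)
  × les (w1 ++ (m ∷ ms) ++ w5) + les′ (m′ ∷ ms′) ≡ les (w1 ++ (m′ ∷ ms′) ++ w5) + les′ (m ∷ ms)
  × res (w1 ++ (m ∷ ms) ++ w5) + res′ (m′ ∷ ms′) ≡ res (w1 ++ (m′ ∷ ms′) ++ w5) + res′ (m ∷ ms)
exchange w1 m ms m′ ms′ w5 l<x h<x i (σ↭ , valleys-σ , noDDesc-σ) =
  (Perm.trans τ↭σ σ↭ ,
   trans (valleys≡countTriples τ)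
     (trans (sym (countTriples-exchange valley₃-local w1 m ms m′ ms′ w5 l<m l<m′ h<t h<t′
                   (valleyCount _ _ l<x h<x)))
            (trans (sym (valleys≡countTriples σ)) valleys-σ)) ,
   countTriples≡0⇒NoDDesc τ
     (trans (sym (countTriples-exchange ddesc₃-local w1 m ms m′ ms′ w5 l<m l<m′ h<t h<t′
                   (ddescCount _ _ l<x h<x)))
            (NoDDesc⇒countTriples≡0 σ noDDesc-σ))) ,
  subst₂ (λ u v → u + les′ (m′ ∷ ms′) ≡ v + les′ (m ∷ ms)) (sym (les≡les′ σ)) (sym (les≡les′ τ))
    (les′-exchange w1 m ms m′ ms′ w5 (<⇒≤ l<m) (<⇒≤ l<m′) permutation (λ c → descents _ c h<x)) ,
  subst₂ (λ u v → u + res′ (m′ ∷ ms′) ≡ v + res′ (m ∷ ms)) (sym (res≡res′ σ)) (sym (res≡res′ τ))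
    (res′-exchange w1 m ms m′ ms′ w5 (<⇒≤ h<t) (<⇒≤ h<t′) permutation (λ c → ascents _ c l<x))
  where
  open Interchangeable i
  σ τ : List ℕ
  σ = w1 ++ (m ∷ ms) ++ w5
  τ = w1 ++ (m′ ∷ ms′) ++ w5
  τ↭σ : τ ↭ σ
  τ↭σ = PP.++⁺ˡ w1 (PP.++⁺ʳ w5 (Perm.↭-sym permutation))
  l<m : lastOr 0 w1 < m
  l<m = <-≤-trans l<x (All.head above)
  l<m′ : lastOr 0 w1 < m′
  l<m′ = <-≤-trans l<x (All.head above′)
  h<t : headOr 0 w5 < lastOr m ms
  h<t = <-≤-trans h<x (All-lastOr m ms above)
  h<t′ : headOr 0 w5 < lastOr m′ ms′
  h<t′ = <-≤-trans h<x (All-lastOr m′ ms′ above′)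

cancel-suc : ∀ a b c → a + c ≡ b + suc c → a ≡ suc b
cancel-suc a b c e = +-cancelʳ-≡ c a (suc b) (trans e (+-suc b c))

GoodStep BadStep : List ℕ → List ℕ → Set
GoodStep σ τ = res τ ≡ suc (res σ) × suc (les τ) ≡ les σ
BadStep  σ τ = suc (res τ) ≡ res σ × les τ ≡ suc (les σ)

record BlockMove (x : ℕ) (M M′ : List ℕ) : Set where
  field
    interchangeable : Interchangeable x M M′
    les′-move       : les′ M ≡ suc (les′ M′)
    res′-move       : res′ M′ ≡ suc (res′ M)

module _ {n k x : ℕ} (w1 : List ℕ) (m : ℕ) (ms : List ℕ) (m′ : ℕ) (ms′ w5 : List ℕ)
         (l<x : lastOr 0 w1 < x) (h<x : headOr 0 w5 < x) (move : BlockMove x (m ∷ ms) (m′ ∷ ms′)) where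
  open BlockMove move

  blockMove-forward : ∀ {σ τ} → σ ≡ w1 ++ (m ∷ ms) ++ w5 → τ ≡ w1 ++ (m′ ∷ ms′) ++ w5 →
    InG n k σ → InG n k τ × GoodStep σ τ
  blockMove-forward {σ} {τ} refl refl g with exchange w1 m ms m′ ms′ w5 l<x h<x interchangeable g
  ... | g′ , les-eq , res-eq =
    g′ ,
    cancel-suc _ _ (res′ (m ∷ ms)) (trans (sym res-eq) (cong (res σ +_) res′-move)) ,
    sym (cancel-suc _ _ (les′ (m′ ∷ ms′)) (trans les-eq (cong (les τ +_) les′-move)))

  blockMove-backward : ∀ {σ τ} → σ ≡ w1 ++ (m′ ∷ ms′) ++ w5 → τ ≡ w1 ++ (m ∷ ms) ++ w5 →
    InG n k σ → InG n k τ × BadStep σ τ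
  blockMove-backward {σ} {τ} refl refl g with exchange w1 m′ ms′ m ms w5 l<x h<x (Interchangeable-sym interchangeable) g
  ... | g′ , les-eq , res-eq =
    g′ ,
    sym (cancel-suc _ _ (res′ (m ∷ ms)) (trans res-eq (cong (res τ +_) res′-move))) ,
    cancel-suc _ _ (les′ (m′ ∷ ms′)) (trans (sym les-eq) (cong (les σ +_) les′-move))

-- The three block moves; in each, every letter of A, B, C exceeds y and x < y

All-<⇒≤ : ∀ {x y} {w : List ℕ} → x < y → All (y <_) w → All (x ≤_) w
All-<⇒≤ x<y = All.map (λ y<c → <⇒≤ (<-trans x<y y<c))

module PeakBlock (a : ℕ) (as : List ℕ) {x y : ℕ} (x<y : x < y) (y<A : All (y <_) (a ∷ as)) where
  private
    A : List ℕ
    A = a ∷ as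
    tA : ℕ
    tA = lastOr a as
    x<A : All (x <_) A
    x<A = All.map (<-trans x<y) y<A
    y<a : y < a
    y<a = All.head y<A
    y<tA : y < tA
    y<tA = All-lastOr a as y<A
    x<a : x < a
    x<a = <-trans x<y y<a
    x<tA : x < tA
    x<tA = <-trans x<y y<tA

    les′-drop : les′ (a ∷ as ++ x ∷ y ∷ []) ≡ suc (les′ (y ∷ x ∷ a ∷ as))
    les′-drop = begin
      les′ (A ++ x ∷ y ∷ [])
        ≡⟨ les′-++ A (x ∷ y ∷ []) ⟩
      les′ A + 0 + (descentsAcross (A ∷ʳ x) x + (descentsAcross (A ∷ʳ x) y + 0))
        ≡⟨ cong₂ (λ u v → les′ A + 0 + (u + (v + 0))) descents-x descents-y ⟩
      les′ A + 0 + (0 + (1 + 0))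
        ≡⟨ rearrange (les′ A) ⟩
      suc (les′ A)
        ≡⟨ cong suc les′-peakFirst ⟨
      suc (les′ (y ∷ x ∷ A))
        ∎
      where
      open ≡-Reasoning
      descents-x : descentsAcross (A ∷ʳ x) x ≡ 0
      descents-x = trans (descentsAcross-∷ʳ A x x) (cong₂ _+_ (descentsAcross-under A x<A) (between-self tA x))
      descents-y : descentsAcross (A ∷ʳ x) y ≡ 1
      descents-y = trans (descentsAcross-∷ʳ A x y) (cong₂ _+_ (descentsAcross-under A y<A) (between-inside tA x y x<y y<tA))
      les′-peakFirst : les′ (y ∷ x ∷ A) ≡ les′ A
      les′-peakFirst = cong₂ (λ u v → u + (v + les′ A))
        (sumMap-zeroᴬ y<A (λ c y<c → between-above y x c (<⇒≤ y<c)))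
        (sumMap-zeroᴬ (All.tail x<A) (λ c x<c → between-above x a c (<⇒≤ x<c)))
      rearrange : ∀ n → n + 0 + (0 + (1 + 0)) ≡ suc n
      rearrange = solve-∀

    res′-rise : res′ (y ∷ x ∷ a ∷ as) ≡ suc (res′ (a ∷ as ++ x ∷ y ∷ []))
    res′-rise = begin
      ascentsAcross (x ∷ A) y + (ascentsAcross A x + res′ A)
        ≡⟨ cong₂ (λ u v → u + (v + res′ A)) ascents-y (ascentsAcross-under A x<A) ⟩
      suc (res′ A)
        ≡⟨ cong suc res′-peakLast ⟨
      suc (res′ (A ++ x ∷ y ∷ []))
        ∎
      where
      open ≡-Reasoning
      ascents-y : ascentsAcross (x ∷ A) y ≡ 1
      ascents-y = cong₂ _+_ (between-inside a x y x<y y<a) (ascentsAcross-under A y<A)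
      res′-peakLast : res′ (A ++ x ∷ y ∷ []) ≡ res′ A
      res′-peakLast = trans (res′-++ A (x ∷ y ∷ []))
        (trans (cong (res′ A + 0 +_) (sumMap-zeroᴬ y<A λ c y<c →
                  cong₂ (λ u v → u + (v + 0)) (between-empty x tA c (<⇒≤ x<tA)) (between-above y x c (<⇒≤ y<c))))
               (trans (+-identityʳ _) (+-identityʳ _)))

    descents-agree : ∀ f c → f < x →
      descentsAcross ((a ∷ as ++ x ∷ y ∷ []) ∷ʳ f) c ≡ descentsAcross ((y ∷ x ∷ a ∷ as) ∷ʳ f) c
    descents-agree f c f<x = begin
      descentsAcross (a ∷ (as ++ x ∷ y ∷ []) ++ f ∷ []) c
        ≡⟨ cong (λ t → descentsAcross (a ∷ t) c) (++-assoc as (x ∷ y ∷ []) (f ∷ [])) ⟩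
      descentsAcross (a ∷ as ++ x ∷ y ∷ f ∷ []) c
        ≡⟨ descentsAcross-++ a as (x ∷ y ∷ f ∷ []) c ⟩
      D + (between tA x c + (between x y c + (between y f c + 0)))
        ≡⟨ cong (λ u → D + (between tA x c + (u + (between y f c + 0)))) (between-empty x y c (<⇒≤ x<y)) ⟩
      D + (between tA x c + (0 + (between y f c + 0)))
        ≡⟨ rearrange D (between tA x c) (between y f c) (between y x c) (between tA f c)
                     (between-exchange c (<⇒≤ f<x) x<y (<⇒≤ y<tA)) ⟩
      between y x c + (0 + (D + between tA f c))
        ≡⟨ cong₂ (λ u v → between y x c + (u + v)) (between-empty x a c (<⇒≤ x<a)) (descentsAcross-∷ʳ A f c) ⟨
      descentsAcross (y ∷ x ∷ A ∷ʳ f) c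
        ∎
      where
      open ≡-Reasoning
      D : ℕ
      D = descentsAcross A c
      rearrange : ∀ d p q r s → p + q ≡ r + s → d + (p + (0 + (q + 0))) ≡ r + (0 + (d + s))
      rearrange d p q r s e = trans (shuffle₁ d p q) (trans (cong (d +_) e) (shuffle₂ d r s))
        where
        shuffle₁ : ∀ d p q → d + (p + (0 + (q + 0))) ≡ d + (p + q)
        shuffle₁ = solve-∀
        shuffle₂ : ∀ d r s → d + (r + s) ≡ r + (0 + (d + s))
        shuffle₂ = solve-∀

    ascents-agree : ∀ l c → l < x →
      ascentsAcross (l ∷ a ∷ as ++ x ∷ y ∷ []) c ≡ ascentsAcross (l ∷ y ∷ x ∷ a ∷ as) c
    ascents-agree l c l<x = begin
      between a l c + ascentsAcross (a ∷ as ++ x ∷ y ∷ []) c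
        ≡⟨ cong (between a l c +_) (ascentsAcross-++ a as (x ∷ y ∷ []) c) ⟩
      between a l c + (U + (between x tA c + (between y x c + 0)))
        ≡⟨ cong (λ u → between a l c + (U + (u + (between y x c + 0)))) (between-empty x tA c (<⇒≤ x<tA)) ⟩
      between a l c + (U + (0 + (between y x c + 0)))
        ≡⟨ rearrange U (between a l c) (between y x c) (between y l c) (between a x c) exchanged ⟩
      between y l c + (0 + (between a x c + U))
        ≡⟨ cong (λ u → between y l c + (u + (between a x c + U))) (between-empty x y c (<⇒≤ x<y)) ⟨
      ascentsAcross (l ∷ y ∷ x ∷ A) c
        ∎
      where
      open ≡-Reasoning
      U : ℕ
      U = ascentsAcross A c
      exchanged : between a l c + between y x c ≡ between y l c + between a x c
      exchanged = trans (+-comm (between a l c) _)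
        (trans (sym (between-exchange c (<⇒≤ l<x) x<y (<⇒≤ y<a))) (+-comm (between a x c) _))
      rearrange : ∀ u p q r s → p + q ≡ r + s → p + (u + (0 + (q + 0))) ≡ r + (0 + (s + u))
      rearrange u p q r s e = trans (shuffle₁ u p q) (trans (cong (u +_) e) (shuffle₂ u r s))
        where
        shuffle₁ : ∀ u p q → p + (u + (0 + (q + 0))) ≡ u + (p + q)
        shuffle₁ = solve-∀
        shuffle₂ : ∀ u r s → u + (r + s) ≡ r + (0 + (s + u))
        shuffle₂ = solve-∀

    counts-agree : ∀ {G} → LocalStatistic G → SameCounts G x (a ∷ as ++ x ∷ y ∷ []) (y ∷ x ∷ a ∷ as)
    counts-agree {G} T l f l<x f<x = begin
      countTriples G l (A ++ x ∷ y ∷ []) f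
        ≡⟨ countTriples-++ G l A (x ∷ y ∷ []) f ⟩
      countTriples G l A x + (G tA x y + (G x y f + 0))
        ≡⟨ cong₂ (λ u v → u + v) inner (cong₂ (λ u v → u + (v + 0)) at-x at-y) ⟩
      countTriples G x A f + (G y x a + (G l y x + 0))
        ≡⟨ rearrange (countTriples G x A f) (G y x a) (G l y x) ⟩
      countTriples G l (y ∷ x ∷ A) f
        ∎
      where
      open ≡-Reasoning
      open LocalStatistic T
      inner : countTriples G l A x ≡ countTriples G x A f
      inner = countTriples-local T l x a as x f (<-trans l<x x<a) x<a x<tA (<-trans f<x x<tA)
      at-x : G tA x y ≡ G y x a
      at-x = trans (left tA y x y (inj₂ (x<tA , x<y))) (right y x y a (inj₂ (x<y , x<a)))
      at-y : G x y f ≡ G l y x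
      at-y = trans (left x l y f (inj₁ (x<y , <-trans l<x x<y))) (right l y f x (inj₁ (<-trans f<x x<y , x<y)))
      rearrange : ∀ b v p → b + (v + (p + 0)) ≡ p + (v + b)
      rearrange = solve-∀

  move : BlockMove x (a ∷ as ++ x ∷ y ∷ []) (y ∷ x ∷ a ∷ as)
  move = record
    { interchangeable = record
      { above       = AllP.++⁺ (All-<⇒≤ x<y y<A) (≤-refl ∷ <⇒≤ x<y ∷ [])
      ; above′      = <⇒≤ x<y ∷ ≤-refl ∷ All-<⇒≤ x<y y<A
      ; permutation = Perm.trans (PP.++-comm A (x ∷ y ∷ [])) (Perm.swap x y Perm.refl)
      ; descents    = descents-agree
      ; ascents     = ascents-agree
      ; valleyCount = counts-agree valley₃-local
      ; ddescCount  = counts-agree ddesc₃-local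
      }
    ; les′-move = les′-drop
    ; res′-move = res′-rise
    }

module DAscBlock (a : ℕ) (as : List ℕ) (b : ℕ) (bs : List ℕ) {x y : ℕ} (x<y : x < y)
                 (y<A : All (y <_) (a ∷ as)) (y<B : All (y <_) (b ∷ bs)) where
  private
    A B : List ℕ
    A = a ∷ as
    B = b ∷ bs
    tA tB : ℕ
    tA = lastOr a as
    tB = lastOr b bs
    x<A : All (x <_) A
    x<A = All.map (<-trans x<y) y<A
    x<B : All (x <_) B
    x<B = All.map (<-trans x<y) y<B
    y<a : y < a
    y<a = All.head y<A
    y<b : y < b
    y<b = All.head y<B
    y<tA : y < tA
    y<tA = All-lastOr a as y<A
    x<a : x < a
    x<a = <-trans x<y y<a
    x<b : x < b
    x<b = <-trans x<y y<b
    x<tA : x < tA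
    x<tA = <-trans x<y y<tA
    x<tB : x < tB
    x<tB = <-trans x<y (All-lastOr b bs y<B)

    K : ℕ
    K = sumMap (descentsAcross (A ∷ʳ x)) B
    descents-x : descentsAcross (A ∷ʳ x) x ≡ 0
    descents-x = trans (descentsAcross-∷ʳ A x x) (cong₂ _+_ (descentsAcross-under A x<A) (between-self tA x))
    descents-y : descentsAcross (A ∷ʳ x) y ≡ 1
    descents-y = trans (descentsAcross-∷ʳ A x y) (cong₂ _+_ (descentsAcross-under A y<A) (between-inside tA x y x<y y<tA))

    les′-ascentLast : les′ (a ∷ as ++ x ∷ y ∷ b ∷ bs) ≡ les′ A + les′ B + 1 + K
    les′-ascentLast = trans (les′-++ A (x ∷ y ∷ B))
      (trans (cong₂ (λ u v → les′ A + u + v)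
               (cong₂ (λ u v → u + (v + les′ B)) (sumMap-zero B λ c → between-empty x y c (<⇒≤ x<y))
                                                  (sumMap-zero bs λ c → between-empty y b c (<⇒≤ y<b)))
               (cong₂ (λ u v → u + (v + K)) descents-x descents-y))
             (rearrange (les′ A) (les′ B) K))
      where
      rearrange : ∀ p q r → p + (0 + (0 + q)) + (0 + (1 + r)) ≡ p + q + 1 + r
      rearrange = solve-∀

    les′-ascentFirst : les′ (y ∷ a ∷ as ++ x ∷ b ∷ bs) ≡ les′ A + les′ B + K
    les′-ascentFirst = cong₂ _+_ (sumMap-zero (as ++ x ∷ B) λ c → between-empty y a c (<⇒≤ y<a))
      (trans (les′-++ A (x ∷ B))
             (cong₂ (λ u v → les′ A + u + v) (cong (_+ les′ B) (sumMap-zero bs λ c → between-empty x b c (<⇒≤ x<b)))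
                                             (cong (_+ K) descents-x)))

    les′-drop : les′ (a ∷ as ++ x ∷ y ∷ b ∷ bs) ≡ suc (les′ (y ∷ a ∷ as ++ x ∷ b ∷ bs))
    les′-drop = trans les′-ascentLast (trans (rearrange (les′ A) (les′ B) K) (cong suc (sym les′-ascentFirst)))
      where
      rearrange : ∀ p q r → p + q + 1 + r ≡ suc (p + q + r)
      rearrange = solve-∀

    res′-ascentLast : res′ (a ∷ as ++ x ∷ y ∷ b ∷ bs) ≡ res′ A + res′ B + sumMap (ascentsAcross (y ∷ B)) A
    res′-ascentLast = trans (res′-++ A (x ∷ y ∷ B))
      (cong₂ (λ u v → res′ A + u + v)
        (cong₂ (λ u v → u + (v + res′ B)) (cong₂ _+_ (between-below b y x (<⇒≤ x<y)) (ascentsAcross-under B x<B))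
                                          (ascentsAcross-under B y<B))
        (sumMap-congᴬ y<A λ c y<c → cong₂ (λ u v → u + (v + ascentsAcross (y ∷ B) c))
                                          (between-empty x tA c (<⇒≤ x<tA)) (between-above y x c (<⇒≤ y<c))))

    res′-ascentFirst : res′ (y ∷ a ∷ as ++ x ∷ b ∷ bs) ≡ suc (res′ A + res′ B + sumMap (ascentsAcross (y ∷ B)) A)
    res′-ascentFirst = cong₂ _+_
      (trans (ascentsAcross-++ a as (x ∷ B) y)
        (trans (cong₂ (λ u v → u + (v + (between b x y + ascentsAcross B y))) (ascentsAcross-under A y<A) (between-empty x tA y (<⇒≤ x<tA)))
               (cong₂ (λ u v → 0 + (0 + (u + v))) (between-inside b x y x<y y<b) (ascentsAcross-under B y<B))))
      (trans (res′-++ A (x ∷ B))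
        (cong₂ (λ u v → res′ A + u + v) (cong (_+ res′ B) (ascentsAcross-under B x<B))
          (sumMap-congᴬ y<A λ c y<c → cong₂ (λ u v → u + (v + ascentsAcross B c))
                                            (between-empty x tA c (<⇒≤ x<tA)) (between-lower-irrelevant b x y c (<-trans x<y y<c) y<c))))

    res′-rise : res′ (y ∷ a ∷ as ++ x ∷ b ∷ bs) ≡ suc (res′ (a ∷ as ++ x ∷ y ∷ b ∷ bs))
    res′-rise = trans res′-ascentFirst (cong suc (sym res′-ascentLast))

    descents-agree : ∀ f c → f < x →
      descentsAcross ((a ∷ as ++ x ∷ y ∷ b ∷ bs) ∷ʳ f) c ≡ descentsAcross ((y ∷ a ∷ as ++ x ∷ b ∷ bs) ∷ʳ f) c
    descents-agree f c _ = trans (cong (λ t → descentsAcross (a ∷ t) c) (++-assoc as (x ∷ y ∷ B) (f ∷ [])))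
      (trans (descentsAcross-++ a as (x ∷ y ∷ b ∷ (bs ∷ʳ f)) c)
      (trans (cong₂ (λ u v → D + (between tA x c + (u + (v + E)))) (between-empty x y c (<⇒≤ x<y)) (between-empty y b c (<⇒≤ y<b)))
      (sym (trans (cong (λ t → descentsAcross (y ∷ a ∷ t) c) (++-assoc as (x ∷ B) (f ∷ [])))
      (trans (cong (between y a c +_) (descentsAcross-++ a as (x ∷ b ∷ (bs ∷ʳ f)) c))
             (cong₂ (λ u v → u + (D + (between tA x c + (v + E)))) (between-empty y a c (<⇒≤ y<a)) (between-empty x b c (<⇒≤ x<b))))))))
      where
      D E : ℕ
      D = descentsAcross A c
      E = descentsAcross (b ∷ (bs ∷ʳ f)) c

    ascents-agree : ∀ l c → l < x →
      ascentsAcross (l ∷ a ∷ as ++ x ∷ y ∷ b ∷ bs) c ≡ ascentsAcross (l ∷ y ∷ a ∷ as ++ x ∷ b ∷ bs) c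
    ascents-agree l c l<x = begin
      between a l c + ascentsAcross (a ∷ as ++ x ∷ y ∷ B) c
        ≡⟨ cong (between a l c +_) (ascentsAcross-++ a as (x ∷ y ∷ B) c) ⟩
      between a l c + (U + (between x tA c + (between y x c + (between b y c + V))))
        ≡⟨ cong (λ u → between a l c + (U + (u + (between y x c + (between b y c + V))))) (between-empty x tA c (<⇒≤ x<tA)) ⟩
      between a l c + (U + (0 + (between y x c + (between b y c + V))))
        ≡⟨ rearrange U (between a l c) (between y x c) (between b y c) (between y l c) (between a y c) (between b x c) (between a x c)
                     (between-exchange c (<⇒≤ l<x) x<y (<⇒≤ y<a)) (between-exchange′ c x<y y<a y<b) ⟩
      between y l c + (between a y c + (U + (0 + (between b x c + V))))
        ≡⟨ cong (λ u → between y l c + (between a y c + (U + (u + (between b x c + V))))) (between-empty x tA c (<⇒≤ x<tA)) ⟨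
      between y l c + (between a y c + (U + (between x tA c + (between b x c + V))))
        ≡⟨ cong (λ u → between y l c + (between a y c + u)) (ascentsAcross-++ a as (x ∷ B) c) ⟨
      ascentsAcross (l ∷ y ∷ a ∷ as ++ x ∷ B) c
        ∎
      where
      open ≡-Reasoning
      U V : ℕ
      U = ascentsAcross A c
      V = ascentsAcross B c
      -- The two exchange identities share the term w = between a x c, which is cancelled.
      rearrange : ∀ u p q r s t v w → w + s ≡ q + p → w + r ≡ t + v →
        p + (u + (0 + (q + (r + V)))) ≡ s + (t + (u + (0 + (v + V))))
      rearrange u p q r s t v w e₁ e₂ = +-cancelˡ-≡ w _ _
        (trans (shuffle₁ u p q r w V) (trans (cong (p + q + u + V +_) e₂)
        (trans (shuffle₂ u p q t v V) (trans (cong (_+ (t + u + v + V)) (sym e₁)) (shuffle₃ u s t v w V)))))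
        where
        shuffle₁ : ∀ u p q r w z → w + (p + (u + (0 + (q + (r + z))))) ≡ p + q + u + z + (w + r)
        shuffle₁ = solve-∀
        shuffle₂ : ∀ u p q t v z → p + q + u + z + (t + v) ≡ q + p + (t + u + v + z)
        shuffle₂ = solve-∀
        shuffle₃ : ∀ u s t v w z → w + s + (t + u + v + z) ≡ w + (s + (t + (u + (0 + (v + z)))))
        shuffle₃ = solve-∀

    counts-agree : ∀ {G} → LocalStatistic G → SameCounts G x (a ∷ as ++ x ∷ y ∷ b ∷ bs) (y ∷ a ∷ as ++ x ∷ b ∷ bs)
    counts-agree {G} T l f l<x f<x = begin
      countTriples G l (A ++ x ∷ y ∷ B) f
        ≡⟨ countTriples-++ G l A (x ∷ y ∷ B) f ⟩
      countTriples G l A x + (G tA x y + (G x y b + countTriples G y B f))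
        ≡⟨ cong₂ _+_ inner-A (cong₂ _+_ at-x (cong₂ _+_ at-y inner-B)) ⟩
      countTriples G y A x + (G tA x b + (G l y a + countTriples G x B f))
        ≡⟨ rearrange (countTriples G y A x) (G tA x b) (G l y a) (countTriples G x B f) ⟩
      G l y a + (countTriples G y A x + (G tA x b + countTriples G x B f))
        ≡⟨ cong (G l y a +_) (countTriples-++ G y A (x ∷ B) f) ⟨
      countTriples G l (y ∷ A ++ x ∷ B) f
        ∎
      where
      open ≡-Reasoning
      open LocalStatistic T
      inner-A : countTriples G l A x ≡ countTriples G y A x
      inner-A = countTriples-local T l y a as x x (<-trans l<x x<a) y<a x<tA x<tA
      inner-B : countTriples G y B f ≡ countTriples G x B f
      inner-B = countTriples-local T y x b bs f f y<b x<b (<-trans f<x x<tB) (<-trans f<x x<tB)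
      at-x : G tA x y ≡ G tA x b
      at-x = right tA x y b (inj₂ (x<y , x<b))
      at-y : G x y b ≡ G l y a
      at-y = trans (left x l y b (inj₁ (x<y , <-trans l<x x<y))) (right l y b a (inj₂ (y<b , y<a)))
      rearrange : ∀ p q r s → p + (q + (r + s)) ≡ r + (p + (q + s))
      rearrange = solve-∀

  move : BlockMove x (a ∷ as ++ x ∷ y ∷ b ∷ bs) (y ∷ a ∷ as ++ x ∷ b ∷ bs)
  move = record
    { interchangeable = record
      { above       = AllP.++⁺ (All-<⇒≤ x<y y<A) (≤-refl ∷ <⇒≤ x<y ∷ All-<⇒≤ x<y y<B)
      ; above′      = <⇒≤ x<y ∷ AllP.++⁺ (All-<⇒≤ x<y y<A) (≤-refl ∷ All-<⇒≤ x<y y<B)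
      ; permutation = Perm.trans (Perm.↭-reflexive (sym (++-assoc A (x ∷ []) (y ∷ B))))
                        (Perm.trans (PP.shift y (A ++ x ∷ []) B) (Perm.↭-reflexive (cong (y ∷_) (++-assoc A (x ∷ []) B))))
      ; descents    = descents-agree
      ; ascents     = ascents-agree
      ; valleyCount = counts-agree valley₃-local
      ; ddescCount  = counts-agree ddesc₃-local
      }
    ; les′-move = les′-drop
    ; res′-move = res′-rise
    }

module ValleyBlock (a : ℕ) (as : List ℕ) (b : ℕ) (bs : List ℕ) (c : ℕ) (cs : List ℕ) {x y : ℕ} (x<y : x < y)
                   (y<A : All (y <_) (a ∷ as)) (y<B : All (y <_) (b ∷ bs)) (y<C : All (y <_) (c ∷ cs)) where
  private
    A B C : List ℕ
    A = a ∷ as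
    B = b ∷ bs
    C = c ∷ cs
    tA tB : ℕ
    tA = lastOr a as
    tB = lastOr b bs
    y<b : y < b
    y<b = All.head y<B
    y<c : y < c
    y<c = All.head y<C
    y<tA : y < tA
    y<tA = All-lastOr a as y<A
    y<tB : y < tB
    y<tB = All-lastOr b bs y<B

    -- block x y is the block of σ and block y x that of τ; general slots treat both at once.
    block : ℕ → ℕ → List ℕ
    block z z′ = a ∷ as ++ z ∷ b ∷ bs ++ z′ ∷ c ∷ cs

    lesCommon : ℕ
    lesCommon = les′ A + les′ B + les′ C + sumMap (descentsAcross (A ∷ʳ x)) B
       + sumMap (descentsAcross (A ∷ʳ x)) C + sumMap (descentsAcross (B ∷ʳ x)) C

    les′-block : ∀ z z′ → z ≤ y → z′ ≤ y → les′ (block z z′) ≡ lesCommon + between tA z z′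
    les′-block z z′ z≤y z′≤y = trans (les′-++ A (z ∷ B ++ z′ ∷ C))
      (trans (cong₂ (λ u v → les′ A + u + v) middle crossing)
             (rearrange (les′ A) (les′ B) (les′ C) (sumMap (descentsAcross (A ∷ʳ x)) B)
                        (sumMap (descentsAcross (A ∷ʳ x)) C) (sumMap (descentsAcross (B ∷ʳ x)) C) (between tA z z′)))
      where
      lower : ∀ {w} → All (y <_) w → ∀ v {t} → t ≤ y → All (λ u → descentsAcross (v ∷ʳ t) u ≡ descentsAcross (v ∷ʳ x) u) w
      lower y<w v t≤y = All.map (λ y<u → descentsAcross-∷ʳ-lower v x _ _ (<-trans x<y y<u) (≤-<-trans t≤y y<u)) y<w
      middle : les′ (z ∷ b ∷ bs ++ z′ ∷ C) ≡ 0 + (les′ B + (0 + les′ C) + (0 + sumMap (descentsAcross (B ∷ʳ x)) C))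
      middle = cong₂ _+_ (sumMap-zero (bs ++ z′ ∷ C) λ u → between-empty z b u (<⇒≤ (≤-<-trans z≤y y<b)))
        (trans (les′-++ B (z′ ∷ C)) (cong₂ (λ u v → les′ B + u + v)
          (cong (_+ les′ C) (sumMap-zero cs λ u → between-empty z′ c u (<⇒≤ (≤-<-trans z′≤y y<c))))
          (cong₂ _+_ (trans (descentsAcross-∷ʳ B z′ z′)
                            (cong₂ _+_ (descentsAcross-under B (All.map (≤-<-trans z′≤y) y<B)) (between-self tB z′)))
                     (sumMap-congᴬ (lower y<C B z′≤y) λ _ e → e))))
      crossing : sumMap (descentsAcross (A ∷ʳ z)) (z ∷ b ∷ bs ++ z′ ∷ C)
               ≡ 0 + (sumMap (descentsAcross (A ∷ʳ x)) B + ((0 + between tA z z′) + sumMap (descentsAcross (A ∷ʳ x)) C))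
      crossing = cong₂ _+_
        (trans (descentsAcross-∷ʳ A z z) (cong₂ _+_ (descentsAcross-under A (All.map (≤-<-trans z≤y) y<A)) (between-self tA z)))
        (trans (sumMap-++ (descentsAcross (A ∷ʳ z)) B (z′ ∷ C))
          (cong₂ _+_ (sumMap-congᴬ (lower y<B A z≤y) λ _ e → e)
            (cong₂ _+_ (trans (descentsAcross-∷ʳ A z z′) (cong (_+ between tA z z′) (descentsAcross-under A (All.map (≤-<-trans z′≤y) y<A))))
                       (sumMap-congᴬ (lower y<C A z≤y) λ _ e → e))))
      rearrange : ∀ p q r s t u v → p + (0 + (q + (0 + r) + (0 + u))) + (0 + (s + ((0 + v) + t))) ≡ p + q + r + s + t + u + v
      rearrange = solve-∀

    ascentsAfter-B ascentsAfter-A : ℕ → ℕ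
    ascentsAfter-B u = between c x u + ascentsAcross C u
    ascentsAfter-A u = between b x u + (ascentsAcross B u + ascentsAfter-B u)

    resCommon : ℕ
    resCommon = res′ A + res′ B + res′ C + sumMap ascentsAfter-B B + sumMap ascentsAfter-A A

    res′-block : ∀ z z′ → z ≤ y → z′ ≤ y → res′ (block z z′) ≡ resCommon + between c z′ z
    res′-block z z′ z≤y z′≤y = trans (res′-++ A (z ∷ B ++ z′ ∷ C))
      (trans (cong₂ (λ u v → res′ A + u + v) middle (sumMap-congᴬ (after-A y<A) λ _ e → e))
             (rearrange (res′ A) (res′ B) (res′ C) (sumMap ascentsAfter-B B) (sumMap ascentsAfter-A A) (between c z′ z)))
      where
      after-B : ∀ {w} → All (y <_) w → All (λ u → ascentsAcross (tB ∷ z′ ∷ C) u ≡ ascentsAfter-B u) w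
      after-B = All.map λ y<u →
        cong₂ _+_ (between-empty z′ tB _ (≤-trans z′≤y (<⇒≤ y<tB)))
                  (cong (_+ ascentsAcross C _) (between-lower-irrelevant c z′ x _ (≤-<-trans z′≤y y<u) (<-trans x<y y<u)))
      after-A : ∀ {w} → All (y <_) w → All (λ u → ascentsAcross (tA ∷ z ∷ b ∷ bs ++ z′ ∷ C) u ≡ ascentsAfter-A u) w
      after-A = All.map λ {u} y<u →
        cong₂ _+_ (between-empty z tA u (≤-trans z≤y (<⇒≤ y<tA)))
          (cong₂ _+_ (between-lower-irrelevant b z x u (≤-<-trans z≤y y<u) (<-trans x<y y<u))
            (trans (ascentsAcross-++ b bs (z′ ∷ C) u)
              (cong (ascentsAcross B u +_)
                (cong₂ _+_ (between-empty z′ tB u (≤-trans z′≤y (<⇒≤ y<tB)))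
                           (cong (_+ ascentsAcross C u) (between-lower-irrelevant c z′ x u (≤-<-trans z′≤y y<u) (<-trans x<y y<u)))))))
      middle : res′ (z ∷ b ∷ bs ++ z′ ∷ C) ≡ (0 + (0 + (between c z′ z + 0))) + (res′ B + (0 + res′ C) + sumMap ascentsAfter-B B)
      middle = cong₂ _+_
        (trans (ascentsAcross-++ b bs (z′ ∷ C) z)
          (cong₂ _+_ (ascentsAcross-under B (All.map (≤-<-trans z≤y) y<B))
            (cong₂ (λ u v → u + (between c z′ z + v)) (between-empty z′ tB z (≤-trans z′≤y (<⇒≤ y<tB)))
                                                       (ascentsAcross-under C (All.map (≤-<-trans z≤y) y<C)))))
        (trans (res′-++ B (z′ ∷ C))
          (cong₂ (λ u v → res′ B + u + v) (cong (_+ res′ C) (ascentsAcross-under C (All.map (≤-<-trans z′≤y) y<C)))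
                                          (sumMap-congᴬ (after-B y<B) λ _ e → e)))
      rearrange : ∀ p q r s t v → p + ((0 + (0 + (v + 0))) + (q + (0 + r) + s)) + t ≡ p + q + r + s + t + v
      rearrange = solve-∀

    les′-drop : les′ (block x y) ≡ suc (les′ (block y x))
    les′-drop = begin
      les′ (block x y)      ≡⟨ les′-block x y (<⇒≤ x<y) ≤-refl ⟩
      lesCommon + between tA x y   ≡⟨ cong (lesCommon +_) (between-inside tA x y x<y y<tA) ⟩
      lesCommon + 1                ≡⟨ +-suc lesCommon 0 ⟩
      suc (lesCommon + 0)          ≡⟨ cong (λ u → suc (lesCommon + u)) (between-below tA y x (<⇒≤ x<y)) ⟨
      suc (lesCommon + between tA y x) ≡⟨ cong suc (les′-block y x ≤-refl (<⇒≤ x<y)) ⟨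
      suc (les′ (block y x)) ∎
      where open ≡-Reasoning

    res′-rise : res′ (block y x) ≡ suc (res′ (block x y))
    res′-rise = begin
      res′ (block y x)      ≡⟨ res′-block y x ≤-refl (<⇒≤ x<y) ⟩
      resCommon + between c x y    ≡⟨ cong (resCommon +_) (between-inside c x y x<y y<c) ⟩
      resCommon + 1                ≡⟨ +-suc resCommon 0 ⟩
      suc (resCommon + 0)          ≡⟨ cong (λ u → suc (resCommon + u)) (between-below c y x (<⇒≤ x<y)) ⟨
      suc (resCommon + between c y x) ≡⟨ cong suc (res′-block x y (<⇒≤ x<y) ≤-refl) ⟨
      suc (res′ (block x y)) ∎
      where open ≡-Reasoning

    descents-block : ∀ z z′ f u → z ≤ y → z′ ≤ y →
      descentsAcross (block z z′ ∷ʳ f) u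
        ≡ descentsAcross A u + (between tA z u + (descentsAcross B u + (between tB z′ u + descentsAcross (C ∷ʳ f) u)))
    descents-block z z′ f u z≤y z′≤y =
      trans (cong (λ t → descentsAcross (a ∷ t) u)
                  (trans (++-assoc as (z ∷ B ++ z′ ∷ C) (f ∷ [])) (cong (λ t → as ++ z ∷ b ∷ t) (++-assoc bs (z′ ∷ C) (f ∷ [])))))
      (trans (descentsAcross-++ a as (z ∷ b ∷ bs ++ z′ ∷ c ∷ (cs ++ f ∷ [])) u)
      (cong (λ t → descentsAcross A u + (between tA z u + t))
        (trans (cong₂ _+_ (between-empty z b u (≤-trans z≤y (<⇒≤ y<b))) (descentsAcross-++ b bs (z′ ∷ c ∷ (cs ++ f ∷ [])) u))
               (cong (λ t → descentsAcross B u + (between tB z′ u + t))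
                     (cong (_+ descentsAcross (C ∷ʳ f) u) (between-empty z′ c u (≤-trans z′≤y (<⇒≤ y<c))))))))

    descents-agree : ∀ f u → f < x → descentsAcross (block x y ∷ʳ f) u ≡ descentsAcross (block y x ∷ʳ f) u
    descents-agree f u _ = trans (descents-block x y f u (<⇒≤ x<y) ≤-refl)
      (trans (rearrange (descentsAcross A u) (descentsAcross B u) (descentsAcross (C ∷ʳ f) u)
                        (between tA x u) (between tB y u) (between tA y u) (between tB x u) (between-exchange′ u x<y y<tA y<tB))
             (sym (descents-block y x f u ≤-refl (<⇒≤ x<y))))
      where
      rearrange : ∀ d e g p q r s → p + q ≡ r + s → d + (p + (e + (q + g))) ≡ d + (r + (e + (s + g)))
      rearrange d e g p q r s pq≡rs = trans (shuffle d e g p q) (trans (cong (d + e + g +_) pq≡rs) (sym (shuffle d e g r s)))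
        where
        shuffle : ∀ d e g p q → d + (p + (e + (q + g))) ≡ d + e + g + (p + q)
        shuffle = solve-∀

    ascents-block : ∀ z z′ l u → z ≤ y → z′ ≤ y →
      ascentsAcross (l ∷ block z z′) u
        ≡ between a l u + (ascentsAcross A u + (between b z u + (ascentsAcross B u + (between c z′ u + ascentsAcross C u))))
    ascents-block z z′ l u z≤y z′≤y = cong (between a l u +_)
      (trans (ascentsAcross-++ a as (z ∷ B ++ z′ ∷ C) u)
        (cong (ascentsAcross A u +_)
          (trans (cong (_+ (between b z u + ascentsAcross (b ∷ bs ++ z′ ∷ C) u)) (between-empty z tA u (≤-trans z≤y (<⇒≤ y<tA))))
                 (cong (between b z u +_) (trans (ascentsAcross-++ b bs (z′ ∷ C) u)
                   (cong (ascentsAcross B u +_) (cong (_+ (between c z′ u + ascentsAcross C u))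
                                                      (between-empty z′ tB u (≤-trans z′≤y (<⇒≤ y<tB))))))))))

    ascents-agree : ∀ l u → l < x → ascentsAcross (l ∷ block x y) u ≡ ascentsAcross (l ∷ block y x) u
    ascents-agree l u _ = trans (ascents-block x y l u (<⇒≤ x<y) ≤-refl)
      (trans (rearrange (between a l u) (ascentsAcross A u) (ascentsAcross B u) (ascentsAcross C u)
                        (between b x u) (between c y u) (between b y u) (between c x u) (between-exchange′ u x<y y<b y<c))
             (sym (ascents-block y x l u ≤-refl (<⇒≤ x<y))))
      where
      rearrange : ∀ k d e g p q r s → p + q ≡ r + s → k + (d + (p + (e + (q + g)))) ≡ k + (d + (r + (e + (s + g))))
      rearrange k d e g p q r s pq≡rs = trans (shuffle k d e g p q) (trans (cong (k + d + e + g +_) pq≡rs) (sym (shuffle k d e g r s)))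
        where
        shuffle : ∀ k d e g p q → k + (d + (p + (e + (q + g)))) ≡ k + d + e + g + (p + q)
        shuffle = solve-∀

    counts-block : ∀ {G} → LocalStatistic G → ∀ l f z z′ → l < x → f < x → z ≤ y → z′ ≤ y →
      countTriples G l (block z z′) f
        ≡ countTriples G l A x + (G tA x b + (countTriples G x B x + (G tB x c + countTriples G x C f)))
    counts-block {G} T l f z z′ l<x f<x z≤y z′≤y = trans (countTriples-++ G l A (z ∷ B ++ z′ ∷ C) f)
      (cong₂ _+_ (countTriples-rightLocal G right l a as z x (inj₁ (≤-<-trans z≤y y<tA , <-trans x<y y<tA)))
        (cong₂ _+_ (valley tA z b tA x b (≤-<-trans z≤y y<tA) (≤-<-trans z≤y y<b) (<-trans x<y y<tA) (<-trans x<y y<b))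
          (trans (countTriples-++ G z B (z′ ∷ C) f)
            (cong₂ _+_ (countTriples-local T z x b bs z′ x (≤-<-trans z≤y y<b) (<-trans x<y y<b)
                                           (≤-<-trans z′≤y y<tB) (<-trans x<y y<tB))
              (cong₂ _+_ (valley tB z′ c tB x c (≤-<-trans z′≤y y<tB) (≤-<-trans z′≤y y<c) (<-trans x<y y<tB) (<-trans x<y y<c))
                         (countTriples-local T z′ x c cs f f (≤-<-trans z′≤y y<c) (<-trans x<y y<c) f<tC f<tC))))))
      where
      open LocalStatistic T
      f<tC : f < lastOr c cs
      f<tC = <-trans f<x (<-trans x<y (All-lastOr c cs y<C))

    counts-agree : ∀ {G} → LocalStatistic G → SameCounts G x (block x y) (block y x)
    counts-agree T l f l<x f<x = trans (counts-block T l f x y l<x f<x (<⇒≤ x<y) ≤-refl)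
                                       (sym (counts-block T l f y x l<x f<x ≤-refl (<⇒≤ x<y)))

  move : BlockMove x (a ∷ as ++ x ∷ b ∷ bs ++ y ∷ c ∷ cs) (a ∷ as ++ y ∷ b ∷ bs ++ x ∷ c ∷ cs)
  move = record
    { interchangeable = record
      { above       = AllP.++⁺ (All-<⇒≤ x<y y<A) (≤-refl ∷ AllP.++⁺ (All-<⇒≤ x<y y<B) (<⇒≤ x<y ∷ All-<⇒≤ x<y y<C))
      ; above′      = AllP.++⁺ (All-<⇒≤ x<y y<A) (<⇒≤ x<y ∷ AllP.++⁺ (All-<⇒≤ x<y y<B) (≤-refl ∷ All-<⇒≤ x<y y<C))
      ; permutation = PP.++⁺ˡ A (Perm.trans (Perm.prep x (PP.shift y B C))
                        (Perm.trans (Perm.swap x y Perm.refl) (Perm.prep y (Perm.↭-sym (PP.shift x B C)))))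
      ; descents    = descents-agree
      ; ascents     = ascents-agree
      ; valleyCount = counts-agree valley₃-local
      ; ddescCount  = counts-agree ddesc₃-local
      }
    ; les′-move = les′-drop
    ; res′-move = res′-rise
    }

-- x-factorizations

minimum-∈ : ∀ a as → minimum (a ∷ as) ∈ (a ∷ as)
minimum-∈ a []       = here refl
minimum-∈ a (b ∷ bs) with minimum-∈ (a ⊓ b) bs
... | there m∈ = there (there m∈)
... | here m≡ with ⊓-sel a b
...   | inj₁ a⊓b≡a = here (trans m≡ a⊓b≡a)
...   | inj₂ a⊓b≡b = there (here (trans m≡ a⊓b≡b))

minimum-≤ : ∀ a as → All (minimum (a ∷ as) ≤_) (a ∷ as)
minimum-≤ a []       = ≤-refl ∷ []
minimum-≤ a (b ∷ bs) with minimum-≤ (a ⊓ b) bs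
... | m≤ ∷ m≤bs = ≤-trans m≤ (m⊓n≤m a b) ∷ ≤-trans m≤ (m⊓n≤n a b) ∷ m≤bs

All-≤-∉⇒< : ∀ {y} w → All (y ≤_) w → y ∉ w → All (y <_) w
All-≤-∉⇒< []      []         _  = []
All-≤-∉⇒< (a ∷ w) (y≤a ∷ ps) y∉ = ≤∧≢⇒< y≤a (λ y≡a → y∉ (here y≡a)) ∷ All-≤-∉⇒< w ps (y∉ ∘ there)

minimum-split : ∀ {c cs} u v y → y ≡ minimum (c ∷ cs) → c ∷ cs ≡ u ++ y ∷ v → Distinct (c ∷ cs) →
  All (y <_) u × All (y <_) v
minimum-split {c} {cs} u v y y≡min e d
  with AllP.++⁻ u (subst (All (y ≤_)) e (subst (λ t → All (t ≤_) (c ∷ cs)) (sym y≡min) (minimum-≤ c cs)))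
     | Distinct-split u y v (subst Distinct e d)
... | y≤u , (_ ∷ y≤v) | y∉u , y∉v = All-≤-∉⇒< u y≤u y∉u , All-≤-∉⇒< v y≤v y∉v

EndsBelow StartsBelow : ℕ → List ℕ → Set
EndsBelow   x w = w ≡ [] ⊎ ∃[ u ] ∃[ z ] (w ≡ u ∷ʳ z × z < x)
StartsBelow x w = w ≡ [] ⊎ ∃[ z ] ∃[ v ] (w ≡ z ∷ v × z < x)

EndsBelow⇒lastOr< : ∀ {x} w → 0 < x → EndsBelow x w → lastOr 0 w < x
EndsBelow⇒lastOr< w 0<x (inj₁ refl)                = 0<x
EndsBelow⇒lastOr< w 0<x (inj₂ (u , z , refl , z<x)) = subst (_< _) (sym (lastOr-∷ʳ 0 u z)) z<x

StartsBelow⇒headOr< : ∀ {x} w → 0 < x → StartsBelow x w → headOr 0 w < x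
StartsBelow⇒headOr< w 0<x (inj₁ refl)                = 0<x
StartsBelow⇒headOr< w 0<x (inj₂ (z , v , refl , z<x)) = z<x

EndsBelow-tail : ∀ {x} c w → EndsBelow x (c ∷ w) → EndsBelow x w
EndsBelow-tail c w (inj₂ ([] , z , e , z<x)) with ∷-injective e
... | _ , refl = inj₁ refl
EndsBelow-tail c w (inj₂ (_ ∷ u , z , e , z<x)) with ∷-injective e
... | _ , refl = inj₂ (u , z , refl , z<x)

EndsBelow-witness : ∀ {x} d w → EndsBelow x (d ∷ w) → ∃[ z ] (z ∈ (d ∷ w) × z < x)
EndsBelow-witness d w (inj₂ (u , z , e , z<x)) = z , subst (z ∈_) (sym e) (∈-++⁺ʳ u (here refl)) , z<x

split-unique : ∀ P Q P′ Q′ x → Distinct (P ++ x ∷ Q) → P ++ x ∷ Q ≡ P′ ++ x ∷ Q′ → P ≡ P′ × Q ≡ Q′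
split-unique []      Q []       Q′ x _ e = refl , ∷-injectiveʳ e
split-unique []      Q (c ∷ P′) Q′ x (x∉ , _) e with ∷-injective e
... | refl , e′ = ⊥-elim (x∉ (subst (x ∈_) (sym e′) (∈-++⁺ʳ P′ (here refl))))
split-unique (c ∷ P) Q []       Q′ x (x∉ , _) e with ∷-injective e
... | refl , _ = ⊥-elim (x∉ (∈-++⁺ʳ P (here refl)))
split-unique (c ∷ P) Q (c′ ∷ P′) Q′ x (_ , d) e with ∷-injective e
... | refl , e′ with split-unique P Q P′ Q′ x d e′
...   | refl , Q≡Q′ = refl , Q≡Q′

aboveSuffix-unique : ∀ {x} w1 w2 v1 v2 → w1 ++ w2 ≡ v1 ++ v2 → All (x <_) w2 → All (x <_) v2 →
  EndsBelow x w1 → EndsBelow x v1 → w2 ≡ v2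
aboveSuffix-unique []       w2 []       v2 e _ _ _ _ = e
aboveSuffix-unique []       w2 (d ∷ v1) v2 e x<w2 _ _ end′ with EndsBelow-witness d v1 end′
... | z , z∈ , z<x = ⊥-elim (<-asym (All.lookup x<w2 (subst (z ∈_) (sym e) (∈-++⁺ˡ z∈))) z<x)
aboveSuffix-unique (d ∷ w1) w2 []       v2 e _ x<v2 end _ with EndsBelow-witness d w1 end
... | z , z∈ , z<x = ⊥-elim (<-asym (All.lookup x<v2 (subst (z ∈_) e (∈-++⁺ˡ z∈))) z<x)
aboveSuffix-unique (d ∷ w1) w2 (d′ ∷ v1) v2 e x<w2 x<v2 end end′ with ∷-injective e
... | refl , e′ = aboveSuffix-unique w1 w2 v1 v2 e′ x<w2 x<v2 (EndsBelow-tail d w1 end) (EndsBelow-tail d v1 end′)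

abovePrefix-unique : ∀ {x} w4 w5 v4 v5 → w4 ++ w5 ≡ v4 ++ v5 → All (x <_) w4 → All (x <_) v4 →
  StartsBelow x w5 → StartsBelow x v5 → w4 ≡ v4
abovePrefix-unique []       w5 []       v5 _ _ _ _ _ = refl
abovePrefix-unique []       w5 (d ∷ v4) v5 () _ _ (inj₁ refl) _
abovePrefix-unique []       w5 (d ∷ v4) v5 refl _ (x<d ∷ _) (inj₂ (_ , _ , refl , d<x)) _ = ⊥-elim (<-asym x<d d<x)
abovePrefix-unique (d ∷ w4) w5 []       v5 () _ _ _ (inj₁ refl)
abovePrefix-unique (d ∷ w4) w5 []       v5 refl (x<d ∷ _) _ _ (inj₂ (_ , _ , refl , d<x)) = ⊥-elim (<-asym x<d d<x)
abovePrefix-unique (d ∷ w4) w5 (d′ ∷ v4) v5 e (_ ∷ x<w4) (_ ∷ x<v4) start start′ with ∷-injective e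
... | refl , e′ = cong (d ∷_) (abovePrefix-unique w4 w5 v4 v5 e′ x<w4 x<v4 start start′)

XFact-unique : ∀ σ x w1 w2 w4 w5 v1 v2 v4 v5 → Distinct σ → XFact σ x w1 w2 w4 w5 → XFact σ x v1 v2 v4 v5 →
  w2 ≡ v2 × w4 ≡ v4
XFact-unique σ x w1 w2 w4 w5 v1 v2 v4 v5 d (e , end , x<w2 , x<w4 , start) (e′ , end′ , x<v2 , x<v4 , start′)
  with split-unique (w1 ++ w2) (w4 ++ w5) (v1 ++ v2) (v4 ++ v5) x
         (subst Distinct (trans e (sym (++-assoc w1 w2 _))) d)
         (trans (++-assoc w1 w2 _) (trans (sym e) (trans e′ (sym (++-assoc v1 v2 _)))))
... | before , after = aboveSuffix-unique w1 w2 v1 v2 before x<w2 x<v2 end end′ ,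
                       abovePrefix-unique w4 w5 v4 v5 after x<w4 x<v4 start start′

maximalAboveSuffix : ∀ x P → ∃[ w1 ] ∃[ w2 ] (P ≡ w1 ++ w2 × All (x <_) w2 ×
  (w1 ≡ [] ⊎ ∃[ u ] ∃[ z ] (w1 ≡ u ∷ʳ z × ¬ x < z)))
maximalAboveSuffix x [] = [] , [] , refl , [] , inj₁ refl
maximalAboveSuffix x (p ∷ P) with maximalAboveSuffix x P
... | q ∷ w1 , w2 , e , x<w2 , inj₂ (u , z , e′ , x≮z) =
      p ∷ q ∷ w1 , w2 , cong (p ∷_) e , x<w2 , inj₂ (p ∷ u , z , cong (p ∷_) e′ , x≮z)
... | [] , w2 , e , x<w2 , _ with x <? p
...   | yes x<p = [] , p ∷ w2 , cong (p ∷_) e , x<p ∷ x<w2 , inj₁ refl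
...   | no x≮p  = p ∷ [] , w2 , cong (p ∷_) e , x<w2 , inj₂ ([] , p , refl , x≮p)

maximalAbovePrefix : ∀ x Q → ∃[ w4 ] ∃[ w5 ] (Q ≡ w4 ++ w5 × All (x <_) w4 ×
  (w5 ≡ [] ⊎ ∃[ z ] ∃[ v ] (w5 ≡ z ∷ v × ¬ x < z)))
maximalAbovePrefix x [] = [] , [] , refl , [] , inj₁ refl
maximalAbovePrefix x (q ∷ Q) with x <? q
... | no x≮q  = [] , q ∷ Q , refl , [] , inj₂ (q , Q , refl , x≮q)
... | yes x<q with maximalAbovePrefix x Q
...   | w4 , w5 , e , x<w4 , rest = q ∷ w4 , w5 , cong (q ∷_) e , x<q ∷ x<w4 , rest

EndsBelow-intro : ∀ {x} P w1 w2 → P ≡ w1 ++ w2 → x ∉ P →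
  (w1 ≡ [] ⊎ ∃[ u ] ∃[ z ] (w1 ≡ u ∷ʳ z × ¬ x < z)) → EndsBelow x w1
EndsBelow-intro P w1 w2 e x∉ (inj₁ w1≡[]) = inj₁ w1≡[]
EndsBelow-intro P w1 w2 e x∉ (inj₂ (u , z , refl , x≮z)) =
  inj₂ (u , z , refl , ≤∧≢⇒< (≮⇒≥ x≮z) λ z≡x → x∉ (subst (_∈ P) z≡x (subst (z ∈_) (sym e) (∈-++⁺ˡ (∈-++⁺ʳ u (here refl))))))

StartsBelow-intro : ∀ {x} Q w4 w5 → Q ≡ w4 ++ w5 → x ∉ Q →
  (w5 ≡ [] ⊎ ∃[ z ] ∃[ v ] (w5 ≡ z ∷ v × ¬ x < z)) → StartsBelow x w5
StartsBelow-intro Q w4 w5 e x∉ (inj₁ w5≡[]) = inj₁ w5≡[]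
StartsBelow-intro Q w4 w5 e x∉ (inj₂ (z , v , refl , x≮z)) =
  inj₂ (z , v , refl , ≤∧≢⇒< (≮⇒≥ x≮z) λ z≡x → x∉ (subst (_∈ Q) z≡x (subst (z ∈_) (sym e) (∈-++⁺ʳ w4 (here refl)))))

-- The transform φ(σ, x)

lastOr-tail : ∀ p u v (x : ℕ) w → lastOr p (u ++ v ++ x ∷ w) ≡ lastOr x w
lastOr-tail p u v x w = trans (lastOr-++ p u _) (lastOr-++ _ v (x ∷ w))

regroup : ∀ w1 (P : List ℕ) (z : ℕ) Q w5 → w1 ++ P ++ z ∷ Q ++ w5 ≡ w1 ++ (P ++ z ∷ Q) ++ w5
regroup w1 P z Q w5 = cong (w1 ++_) (sym (++-assoc P (z ∷ Q) w5))

peak-alone : ∀ {y p q} u v → All (y <_) u → All (y <_) v → lastOr p u < y → headOr q v < y → u ≡ [] × v ≡ []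
peak-alone []       []       _   _         _ _ = refl , refl
peak-alone (d ∷ ds) v        y<u _         l _ = ⊥-elim (<-asym (All-lastOr d ds y<u) l)
peak-alone []       (d ∷ ds) _   (y<d ∷ _) _ r = ⊥-elim (<-asym y<d r)

module Transform {n k : ℕ} (w1 : List ℕ) (a : ℕ) (as : List ℕ) (c : ℕ) (cs : List ℕ) (w5 : List ℕ) {x : ℕ}
  (0<x : 0 < x) (x<A : All (x <_) (a ∷ as)) (x<C : All (x <_) (c ∷ cs))
  (end : EndsBelow x w1) (start : StartsBelow x w5)
  (g : InG n k (w1 ++ (a ∷ as) ++ x ∷ (c ∷ cs) ++ w5)) where

  A C σ : List ℕ
  A = a ∷ as
  C = c ∷ cs
  σ = w1 ++ A ++ x ∷ C ++ w5

  y : ℕ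
  y = minimum A ⊓ minimum C

  xfact : XFact σ x w1 A C w5
  xfact = refl , end , x<A , x<C , start

  private
    l<x : lastOr 0 w1 < x
    l<x = EndsBelow⇒lastOr< w1 0<x end
    h<x : headOr 0 w5 < x
    h<x = StartsBelow⇒headOr< w5 0<x start

    distinct : Distinct σ
    distinct = InG⇒Distinct g
    distinct-right : Distinct (A ++ x ∷ C ++ w5)
    distinct-right = Distinct-++ʳ w1 _ distinct
    distinct-A : Distinct A
    distinct-A = Distinct-++ˡ A _ distinct-right
    distinct-C : Distinct C
    distinct-C = Distinct-++ˡ C w5 (proj₂ (Distinct-++ʳ A (x ∷ C ++ w5) distinct-right))
    A∌C : ∀ {e} → e ∈ A → e ∉ C
    A∌C e∈A e∈C = Distinct-disjoint A (x ∷ C ++ w5) distinct-right e∈A (there (∈-++⁺ˡ e∈C))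

    y<A : y ∈ C → All (y <_) A
    y<A y∈C = All-≤-∉⇒< A (All.map (≤-trans (m⊓n≤m _ _)) (minimum-≤ a as)) (λ y∈A → A∌C y∈A y∈C)
    y<C : y ∈ A → All (y <_) C
    y<C y∈A = All-≤-∉⇒< C (All.map (≤-trans (m⊓n≤n _ _)) (minimum-≤ c cs)) (A∌C y∈A)

    noDDesc : NoDDesc σ
    noDDesc = proj₂ (proj₂ g)

    y∈C : y ≡ minimum C → y ∈ C
    y∈C y≡ = subst (_∈ C) (sym y≡) (minimum-∈ c cs)
    y∈A : y ≡ minimum A → y ∈ A
    y∈A y≡ = subst (_∈ A) (sym y≡) (minimum-∈ a as)

    x<y₂ : y ≡ minimum C → x < y
    x<y₂ y≡ = All.lookup x<C (y∈C y≡)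
    x<y₁ : y ≡ minimum A → x < y
    x<y₁ y≡ = All.lookup x<A (y∈A y≡)

    σ-around-C : ∀ {u v} → C ≡ u ++ y ∷ v → σ ≡ (w1 ++ A ++ x ∷ u) ++ y ∷ (v ++ w5)
    σ-around-C {u} {v} C≡ = begin
      w1 ++ A ++ x ∷ C ++ w5                  ≡⟨ cong (λ t → w1 ++ A ++ x ∷ t ++ w5) C≡ ⟩
      w1 ++ A ++ x ∷ (u ++ y ∷ v) ++ w5       ≡⟨ cong (λ t → w1 ++ A ++ x ∷ t) (++-assoc u (y ∷ v) w5) ⟩
      w1 ++ A ++ x ∷ u ++ y ∷ v ++ w5         ≡⟨ cong (w1 ++_) (++-assoc A (x ∷ u) _) ⟨
      w1 ++ (A ++ x ∷ u) ++ y ∷ v ++ w5       ≡⟨ ++-assoc w1 (A ++ x ∷ u) _ ⟨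
      (w1 ++ A ++ x ∷ u) ++ y ∷ (v ++ w5)     ∎
      where open ≡-Reasoning

    σ-around-A : ∀ {u v} → A ≡ u ++ y ∷ v → σ ≡ (w1 ++ u) ++ y ∷ (v ++ x ∷ C ++ w5)
    σ-around-A {u} {v} A≡ = begin
      w1 ++ A ++ x ∷ C ++ w5                  ≡⟨ cong (λ t → w1 ++ t ++ x ∷ C ++ w5) A≡ ⟩
      w1 ++ (u ++ y ∷ v) ++ x ∷ C ++ w5       ≡⟨ cong (w1 ++_) (++-assoc u (y ∷ v) _) ⟩
      w1 ++ u ++ y ∷ v ++ x ∷ C ++ w5         ≡⟨ ++-assoc w1 u _ ⟨
      (w1 ++ u) ++ y ∷ (v ++ x ∷ C ++ w5)     ∎
      where open ≡-Reasoning

    σ-with-C : ∀ {C′} → C ≡ C′ → σ ≡ w1 ++ (A ++ x ∷ C′) ++ w5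
    σ-with-C C≡ = trans (cong (λ t → w1 ++ A ++ x ∷ t ++ w5) C≡) (regroup w1 A x _ w5)

    σ-with-A : ∀ {A′} → A ≡ A′ → σ ≡ w1 ++ (A′ ++ x ∷ C) ++ w5
    σ-with-A A≡ = trans (cong (λ t → w1 ++ t ++ x ∷ C ++ w5) A≡) (regroup w1 _ x C w5)

  Outcome : List ℕ → Set
  Outcome τ = InG n k τ × (Good σ x → GoodStep σ τ) × (Bad σ x → BadStep σ τ)

  private
    not-bad : y ≡ minimum C → ¬ Bad σ x
    not-bad y≡ (_ , _ , _ , _ , xfact′ , minA<minC) with XFact-unique σ x w1 A C w5 _ _ _ _ distinct xfact xfact′
    ... | refl , refl = <⇒≱ minA<minC (subst (_≤ minimum A) y≡ (m⊓n≤m _ _))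

    not-good : y ≡ minimum A → ¬ Good σ x
    not-good y≡ (_ , _ , _ , _ , xfact′ , minC<minA) with XFact-unique σ x w1 A C w5 _ _ _ _ distinct xfact xfact′
    ... | refl , refl = <⇒≱ minC<minA (subst (_≤ minimum C) y≡ (m⊓n≤n _ _))

    good-outcome : ∀ {τ} → y ≡ minimum C → InG n k τ × GoodStep σ τ → Outcome τ
    good-outcome y≡ (gτ , step) = gτ , (λ _ → step) , (λ bad → ⊥-elim (not-bad y≡ bad))

    bad-outcome : ∀ {τ} → y ≡ minimum A → InG n k τ × BadStep σ τ → Outcome τ
    bad-outcome y≡ (gτ , step) = gτ , (λ good → ⊥-elim (not-good y≡ good)) , (λ _ → step)

    peak-move₂ : IsPeak σ y → y ≡ minimum C → InG n k (w1 ++ y ∷ x ∷ A ++ w5) × GoodStep σ (w1 ++ y ∷ x ∷ A ++ w5)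
    peak-move₂ isPeak y≡ with ∈-∃++ (y∈C y≡)
    ... | u , v , C≡ with minimum-split u v y y≡ C≡ distinct-C
    ... | y<u , y<v with IsPeak⁻ _ y _ (subst Distinct (σ-around-C C≡) distinct) (subst (λ s → IsPeak s y) (σ-around-C C≡) isPeak)
    ... | l , r with peak-alone u v y<u y<v (subst (_< y) (lastOr-tail 0 w1 A x u) l) (subst (_< y) (headOr-++ 0 v w5) r)
    ... | refl , refl = blockMove-forward w1 a (as ++ x ∷ y ∷ []) y (x ∷ a ∷ as) w5 l<x h<x
                          (PeakBlock.move a as (x<y₂ y≡) (y<A (y∈C y≡))) (σ-with-C C≡) refl g

    dasc-move₂ : IsDAsc σ y → y ≡ minimum C → ∀ w″ → C ≡ y ∷ w″ →
      InG n k (w1 ++ (y ∷ A) ++ x ∷ w″ ++ w5) × GoodStep σ (w1 ++ (y ∷ A) ++ x ∷ w″ ++ w5)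
    dasc-move₂ isDAsc y≡ w″ C≡ with minimum-split [] w″ y y≡ C≡ distinct-C
    dasc-move₂ isDAsc y≡ [] C≡ | _ =
      ⊥-elim (<-asym (<-trans h<x (x<y₂ y≡))
        (proj₂ (IsDAsc⁻ _ y w5 (subst Distinct σ≡ distinct) (subst (λ s → IsDAsc s y) σ≡ isDAsc))))
      where
      σ≡ : σ ≡ (w1 ++ A ++ x ∷ []) ++ y ∷ w5
      σ≡ = σ-around-C C≡
    dasc-move₂ isDAsc y≡ (b ∷ bs) C≡ | _ , y<B =
      blockMove-forward w1 a (as ++ x ∷ y ∷ b ∷ bs) y (a ∷ as ++ x ∷ b ∷ bs) w5 l<x h<x
        (DAscBlock.move a as b bs (x<y₂ y≡) (y<A (y∈C y≡)) y<B) (σ-with-C C≡) (regroup w1 (y ∷ A) x (b ∷ bs) w5) g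

    valley-move₂ : y ≡ minimum C → ∀ w′ w″ → w′ ≢ [] → w″ ≢ [] → C ≡ w′ ++ y ∷ w″ →
      InG n k (w1 ++ (A ++ y ∷ w′) ++ x ∷ w″ ++ w5) × GoodStep σ (w1 ++ (A ++ y ∷ w′) ++ x ∷ w″ ++ w5)
    valley-move₂ y≡ []       _         w′≢[] _     _  = ⊥-elim (w′≢[] refl)
    valley-move₂ y≡ (_ ∷ _)  []        _     w″≢[] _  = ⊥-elim (w″≢[] refl)
    valley-move₂ y≡ (b ∷ bs) (c′ ∷ cs′) _    _     C≡ with minimum-split (b ∷ bs) (c′ ∷ cs′) y y≡ C≡ distinct-C
    ... | y<B , y<C′ =
      blockMove-forward w1 a (as ++ x ∷ b ∷ bs ++ y ∷ c′ ∷ cs′) a (as ++ y ∷ b ∷ bs ++ x ∷ c′ ∷ cs′) w5 l<x h<x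
        (ValleyBlock.move a as b bs c′ cs′ (x<y₂ y≡) (y<A (y∈C y≡)) y<B y<C′) (σ-with-C C≡)
        (trans (regroup w1 (A ++ y ∷ b ∷ bs) x (c′ ∷ cs′) w5) (cong (λ t → w1 ++ t ++ w5) (++-assoc A (y ∷ b ∷ bs) (x ∷ c′ ∷ cs′)))) g

    peak-move₁ : IsPeak σ y → y ≡ minimum A → InG n k (w1 ++ C ++ x ∷ y ∷ w5) × BadStep σ (w1 ++ C ++ x ∷ y ∷ w5)
    peak-move₁ isPeak y≡ with ∈-∃++ (y∈A y≡)
    ... | u , v , A≡ with minimum-split u v y y≡ A≡ distinct-A
    ... | y<u , y<v with IsPeak⁻ _ y _ (subst Distinct (σ-around-A A≡) distinct) (subst (λ s → IsPeak s y) (σ-around-A A≡) isPeak)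
    ... | l , r with peak-alone u v y<u y<v (subst (_< y) (lastOr-++ 0 w1 u) l) (subst (_< y) (headOr-++ 0 v (x ∷ C ++ w5)) r)
    ... | refl , refl = blockMove-backward w1 c (cs ++ x ∷ y ∷ []) y (x ∷ c ∷ cs) w5 l<x h<x
                          (PeakBlock.move c cs (x<y₁ y≡) (y<C (y∈A y≡))) (σ-with-A A≡) (regroup w1 C x (y ∷ []) w5) g

    dasc-move₁ : IsDAsc σ y → y ≡ minimum A → ∀ w″ → A ≡ y ∷ w″ →
      InG n k (w1 ++ w″ ++ x ∷ y ∷ C ++ w5) × BadStep σ (w1 ++ w″ ++ x ∷ y ∷ C ++ w5)
    dasc-move₁ isDAsc y≡ w″ A≡ with minimum-split [] w″ y y≡ A≡ distinct-A
    dasc-move₁ isDAsc y≡ [] A≡ | _ =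
      ⊥-elim (<-asym (x<y₁ y≡)
        (proj₂ (IsDAsc⁻ _ y _ (subst Distinct σ≡ distinct) (subst (λ s → IsDAsc s y) σ≡ isDAsc))))
      where
      σ≡ : σ ≡ (w1 ++ []) ++ y ∷ x ∷ C ++ w5
      σ≡ = σ-around-A {[]} {[]} A≡
    dasc-move₁ isDAsc y≡ (b ∷ bs) A≡ | _ , y<B =
      blockMove-backward w1 b (bs ++ x ∷ y ∷ c ∷ cs) y (b ∷ bs ++ x ∷ c ∷ cs) w5 l<x h<x
        (DAscBlock.move b bs c cs (x<y₁ y≡) y<B (y<C (y∈A y≡))) (σ-with-A A≡) (regroup w1 (b ∷ bs) x (y ∷ C) w5) g

    valley-move₁ : y ≡ minimum A → ∀ w′ w″ → w′ ≢ [] → w″ ≢ [] → A ≡ w′ ++ y ∷ w″ →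
      InG n k (w1 ++ w′ ++ x ∷ (w″ ++ y ∷ C) ++ w5) × BadStep σ (w1 ++ w′ ++ x ∷ (w″ ++ y ∷ C) ++ w5)
    valley-move₁ y≡ []         _        w′≢[] _     _  = ⊥-elim (w′≢[] refl)
    valley-move₁ y≡ (_ ∷ _)    []       _     w″≢[] _  = ⊥-elim (w″≢[] refl)
    valley-move₁ y≡ (a′ ∷ as′) (b ∷ bs) _     _     A≡ with minimum-split (a′ ∷ as′) (b ∷ bs) y y≡ A≡ distinct-A
    ... | y<A′ , y<B =
      blockMove-backward w1 a′ (as′ ++ x ∷ b ∷ bs ++ y ∷ c ∷ cs) a′ (as′ ++ y ∷ b ∷ bs ++ x ∷ c ∷ cs) w5 l<x h<x
        (ValleyBlock.move a′ as′ b bs c cs (x<y₁ y≡) y<A′ y<B (y<C (y∈A y≡)))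
        (trans (σ-with-A A≡) (cong (λ t → w1 ++ t ++ w5) (++-assoc (a′ ∷ as′) (y ∷ b ∷ bs) (x ∷ C))))
        (regroup w1 (a′ ∷ as′) x (b ∷ bs ++ y ∷ C) w5) g

  phi-outcome : ∀ τ → PhiCase σ x w1 A C w5 τ → Outcome τ
  phi-outcome _ (peak₂ isPeak y≡)               = good-outcome y≡ (peak-move₂ isPeak y≡)
  phi-outcome _ (dasc₂ isDAsc y≡ w″ C≡)         = good-outcome y≡ (dasc-move₂ isDAsc y≡ w″ C≡)
  phi-outcome _ (val₂ _ y≡ w′ w″ w′≢[] w″≢[] C≡) = good-outcome y≡ (valley-move₂ y≡ w′ w″ w′≢[] w″≢[] C≡)
  phi-outcome _ (peak₁ isPeak y≡)               = bad-outcome y≡ (peak-move₁ isPeak y≡)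
  phi-outcome _ (dasc₁ isDAsc y≡ w″ A≡)         = bad-outcome y≡ (dasc-move₁ isDAsc y≡ w″ A≡)
  phi-outcome _ (val₁ _ y≡ w′ w″ w′≢[] w″≢[] A≡) = bad-outcome y≡ (valley-move₁ y≡ w′ w″ w′≢[] w″≢[] A≡)

  private
    phiCase₂ : y ≡ minimum C → ∃[ τ ] PhiCase σ x w1 A C w5 τ
    phiCase₂ y≡ with ∈-∃++ (y∈C y≡)
    ... | u , v , C≡ with minimum-split u v y y≡ C≡ distinct-C
    ... | y<u , y<v with u | v
    ...   | []     | []     =
      _ , peak₂ (subst (λ s → IsPeak s y) (sym (σ-around-C C≡)) (IsPeak⁺ _ y _ x<y′ (<-trans h<x (x<y₂ y≡)))) y≡
      where
      x<y′ : lastOr 0 (w1 ++ A ++ x ∷ []) < y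
      x<y′ = subst (_< y) (sym (lastOr-tail 0 w1 A x [])) (x<y₂ y≡)
    ...   | []     | d ∷ ds =
      _ , dasc₂ (subst (λ s → IsDAsc s y) (sym (σ-around-C C≡)) (IsDAsc⁺ _ y _ x<y′ (All.head y<v))) y≡ (d ∷ ds) C≡
      where
      x<y′ : lastOr 0 (w1 ++ A ++ x ∷ []) < y
      x<y′ = subst (_< y) (sym (lastOr-tail 0 w1 A x [])) (x<y₂ y≡)
    ...   | d ∷ ds | []     = ⊥-elim (NoDDesc-split _ y _ (subst NoDDesc (σ-around-C C≡) noDDesc) y<l (<-trans h<x (x<y₂ y≡)))
      where
      y<l : y < lastOr 0 (w1 ++ A ++ x ∷ d ∷ ds)
      y<l = subst (y <_) (sym (lastOr-tail 0 w1 A x (d ∷ ds))) (All-lastOr d ds y<u)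
    ...   | d ∷ ds | e ∷ es = _ , val₂ (subst (λ s → IsValley s y) (sym (σ-around-C C≡)) (IsValley⁺ _ y _ y<l (All.head y<v)))
                                     y≡ (d ∷ ds) (e ∷ es) (λ ()) (λ ()) C≡
      where
      y<l : y < lastOr 0 (w1 ++ A ++ x ∷ d ∷ ds)
      y<l = subst (y <_) (sym (lastOr-tail 0 w1 A x (d ∷ ds))) (All-lastOr d ds y<u)

    phiCase₁ : y ≡ minimum A → ∃[ τ ] PhiCase σ x w1 A C w5 τ
    phiCase₁ y≡ with ∈-∃++ (y∈A y≡)
    ... | u , v , A≡ with minimum-split u v y y≡ A≡ distinct-A
    ... | y<u , y<v with u | v
    ...   | []     | []     = _ , peak₁ (subst (λ s → IsPeak s y) (sym (σ-around-A A≡)) (IsPeak⁺ _ y _ l<y (x<y₁ y≡))) y≡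
      where
      l<y : lastOr 0 (w1 ++ []) < y
      l<y = subst (_< y) (sym (lastOr-++ 0 w1 [])) (<-trans l<x (x<y₁ y≡))
    ...   | []     | d ∷ ds =
      _ , dasc₁ (subst (λ s → IsDAsc s y) (sym (σ-around-A A≡)) (IsDAsc⁺ _ y _ l<y (All.head y<v))) y≡ (d ∷ ds) A≡
      where
      l<y : lastOr 0 (w1 ++ []) < y
      l<y = subst (_< y) (sym (lastOr-++ 0 w1 [])) (<-trans l<x (x<y₁ y≡))
    ...   | d ∷ ds | []     = ⊥-elim (NoDDesc-split _ y _ (subst NoDDesc (σ-around-A A≡) noDDesc) y<l (x<y₁ y≡))
      where
      y<l : y < lastOr 0 (w1 ++ d ∷ ds)
      y<l = subst (y <_) (sym (lastOr-++ 0 w1 (d ∷ ds))) (All-lastOr d ds y<u)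
    ...   | d ∷ ds | e ∷ es = _ , val₁ (subst (λ s → IsValley s y) (sym (σ-around-A A≡)) (IsValley⁺ _ y _ y<l (All.head y<v)))
                                     y≡ (d ∷ ds) (e ∷ es) (λ ()) (λ ()) A≡
      where
      y<l : y < lastOr 0 (w1 ++ d ∷ ds)
      y<l = subst (y <_) (sym (lastOr-++ 0 w1 (d ∷ ds))) (All-lastOr d ds y<u)

  phi-exists : ∃[ τ ] Phi σ x τ
  phi-exists with <-cmp (minimum A) (minimum C)
  ... | tri< minA<minC _ _ = let τ , case = phiCase₁ (m≤n⇒m⊓n≡m (<⇒≤ minA<minC)) in τ , w1 , A , C , w5 , xfact , case
  ... | tri> _ _ minC<minA = let τ , case = phiCase₂ (m≥n⇒m⊓n≡n (<⇒≤ minC<minA)) in τ , w1 , A , C , w5 , xfact , case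
  ... | tri≈ _ minA≡minC _ = ⊥-elim (A∌C (minimum-∈ a as) (subst (_∈ C) (sym minA≡minC) (minimum-∈ c cs)))

xFactorization : ∀ {σ x} → Distinct σ → x ∈ σ → ∃[ w1 ] ∃[ w2 ] ∃[ w4 ] ∃[ w5 ] XFact σ x w1 w2 w4 w5
xFactorization {x = x} d x∈σ with ∈-∃++ x∈σ
... | P , Q , refl with maximalAboveSuffix x P | maximalAbovePrefix x Q | Distinct-split P x Q d
... | w1 , w2 , refl , x<w2 , end | w4 , w5 , refl , x<w4 , start | x∉P , x∉Q =
  w1 , w2 , w4 , w5 , ++-assoc w1 w2 (x ∷ w4 ++ w5) ,
  EndsBelow-intro _ w1 w2 refl x∉P end , x<w2 , x<w4 , StartsBelow-intro _ w4 w5 refl x∉Q start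

valley-factors-nonempty : ∀ {n k x} w1 w2 w4 w5 → InG n k (w1 ++ w2 ++ x ∷ w4 ++ w5) →
  IsValley (w1 ++ w2 ++ x ∷ w4 ++ w5) x → 0 < x → EndsBelow x w1 → StartsBelow x w5 → w2 ≢ [] × w4 ≢ []
valley-factors-nonempty {x = x} w1 w2 w4 w5 g valley 0<x end start =
  (λ { refl → <-asym (EndsBelow⇒lastOr< w1 0<x end) (proj₁ (IsValley⁻ w1 x (w4 ++ w5) (InG⇒Distinct g) valley)) }) ,
  (λ { refl → <-asym (StartsBelow⇒headOr< w5 0<x start)
                     (proj₂ (IsValley⁻ (w1 ++ w2) x w5 (subst Distinct σ≡ (InG⇒Distinct g)) (subst (λ s → IsValley s x) σ≡ valley))) })
  where
  σ≡ : w1 ++ w2 ++ x ∷ w5 ≡ (w1 ++ w2) ++ x ∷ w5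
  σ≡ = sym (++-assoc w1 w2 (x ∷ w5))

Phi-exists : ∀ {n k σ x} → InG n k σ → IsValley σ x → 0 < x →
  ∀ {w1 w2 w4 w5} → XFact σ x w1 w2 w4 w5 → ∃[ τ ] Phi σ x τ
Phi-exists g valley 0<x {w1} {[]} {w4} {w5} (refl , end , _ , _ , start) =
  ⊥-elim (proj₁ (valley-factors-nonempty w1 [] w4 w5 g valley 0<x end start) refl)
Phi-exists g valley 0<x {w1} {w2} {[]} {w5} (refl , end , _ , _ , start) =
  ⊥-elim (proj₂ (valley-factors-nonempty w1 w2 [] w5 g valley 0<x end start) refl)
Phi-exists g valley 0<x {w1} {a ∷ as} {c ∷ cs} {w5} (refl , end , x<A , x<C , start) =
  Transform.phi-exists w1 a as c cs w5 0<x x<A x<C end start g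

Phi-outcome : ∀ {n k σ x} → InG n k σ → IsValley σ x → 0 < x → ∀ τ → Phi σ x τ →
  InG n k τ × (Good σ x → GoodStep σ τ) × (Bad σ x → BadStep σ τ)
Phi-outcome g valley 0<x τ (w1 , [] , w4 , w5 , (refl , end , _ , _ , start) , _) =
  ⊥-elim (proj₁ (valley-factors-nonempty w1 [] w4 w5 g valley 0<x end start) refl)
Phi-outcome g valley 0<x τ (w1 , w2 , [] , w5 , (refl , end , _ , _ , start) , _) =
  ⊥-elim (proj₂ (valley-factors-nonempty w1 w2 [] w5 g valley 0<x end start) refl)
Phi-outcome g valley 0<x τ (w1 , a ∷ as , c ∷ cs , w5 , (refl , end , x<A , x<C , start) , case) =
  Transform.phi-outcome w1 a as c cs w5 0<x x<A x<C end start g τ case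

proposition2p8 : (n k : ℕ) (σ : List ℕ) (x : ℕ) → InG n k σ → IsValley σ x →
    (∃[ τ ] Phi σ x τ)
    × ((τ : List ℕ) → Phi σ x τ →
        InG n k τ
        × (Good σ x → res τ ≡ suc (res σ) × suc (les τ) ≡ les σ)
        × (Bad σ x → suc (res τ) ≡ res σ × les τ ≡ suc (les σ)))
proposition2p8 n k σ x g valley =
  Phi-exists g valley 0<x (proj₂ (proj₂ (proj₂ (proj₂ (xFactorization (InG⇒Distinct g) x∈σ))))) ,
  Phi-outcome g valley 0<x
  where
  x∈σ : x ∈ σ
  x∈σ = IsValley⇒∈ σ x valley
  0<x : 0 < x
  0<x = oneTo-positive n (PP.∈-resp-↭ (proj₁ g) x∈σ)
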